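{- For any $k\geq 1$ and any structures $M,N$ over the same relational schema: if $M\approx_{\mathrm{UN}^k} N$, then $M$ and $N$ satisfy the same sentences of $\mathrm{UNFP}^k$. In particular, if $M\approx_{\mathrm{UN}} N$, then $M$ and $N$ satisfy the same sentences of $\mathrm{UNFP}$.
   Context: Structures are relational structures over a finite relational schema. $\mathrm{UNFO}$ (the unary-negation fragment of first-order logic) consists of the formulas generated by $\phi ::= R(\bar x)\mid x=y\mid \phi\wedge\phi\mid\phi\vee\phi\mid\exists x\,\phi\mid\neg\phi$, where in the last clause $\phi$ has at most one free first-order variable. $\mathrm{UNFP}$ is obtained by allowing additionally unary second-order (fixpoint) variables $X$ as atoms $X(x)$ (negation still only applied to formulas with at most one free first-order variable) and least fixpoint formulas $[\mathrm{LFP}_{X,x}\,\phi(X,\bar X,x)](y)$, where $X$ occurs only positively (under an even number of negations) in $\phi$ and $\phi$ has no free first-order variable other than $x$; the semantics is the usual least-fixpoint semantics. A formula is in UN-normal form if every existential quantifier in its syntax tree, except at the root, either is directly below another existential quantifier or starts a subformula with at most one free variable. Every formula can be put into UN-normal form by the rewrite rules $\phi\wedge\exists x\psi\equiv\exists x(\phi\wedge\psi)$ and $\phi\vee\exists x\psi\equiv\exists x(\phi\vee\psi)$ ($x$ not free in $\phi$), with renaming of bound variables where needed. A formula has width $k$ if it can be put into UN-normal form with these rules so that the result uses at most $k$ first-order variables; $\mathrm{UNFP}^k$ is the set of $\mathrm{UNFP}$ formulas of width $k$. A UN-bisimulation of width $k$ between $M$ and $N$ is a relation $Z\subseteq\mathrm{dom}(M)\times\mathrm{dom}(N)$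 such that for every $(a,b)\in Z$: (forward) for every set $X\subseteq\mathrm{dom}(M)$ with $|X|\leq k$ there is a partial homomorphism $h:M\to N$ with domain $X$, with $h(a)=b$ if $a\in X$, and with every pair $(a',h(a'))$ in $Z$; (backward) likewise with the roles of $M$ and $N$ swapped. A UN-bisimulation is defined the same way but for all finite sets $X$. $M\approx_{\mathrm{UN}^k}N$ (resp. $M\approx_{\mathrm{UN}}N$) means there is a non-empty UN-bisimulation of width $k$ (resp. non-empty UN-bisimulation) between $M$ and $N$. -}

module Defs where

open import Level using (Lift; 0ℓ) renaming (suc to lsuc)
open import Data.Nat using (ℕ; _≤_; _≡ᵇ_)
open import Data.Bool using (Bool; true; false; if_then_else_; not)
open import Data.Fin using (Fin)
open import Data.Vec using (Vec; toList) renaming (map to vmap)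
open import Data.List using (List; []; _∷_; _++_; length)
open import Data.List.Membership.Propositional using (_∈_; _∉_)
open import Data.Product using (Σ; Σ-syntax; ∃; ∃-syntax; _×_; _,_)
open import Data.Sum using (_⊎_)
open import Data.Empty using (⊥)
open import Data.Unit using (⊤)
open import Relation.Nullary using (¬_)
open import Relation.Binary.PropositionalEquality using (_≡_; _≢_)
open import Relation.Binary.Construct.Closure.Symmetric using (SymClosure)
open import Relation.Binary.Construct.Closure.ReflexiveTransitive using (Star)

record Schema : Set where
  field
    size  : ℕ
    arity : Fin size → ℕ

open Schema public

record Structure (σ : Schema) : Set₁ where
  field
    Carrier : Set
    rel     : (R : Fin (size σ)) → Vec Carrier (arity σ R) → Set

open Structure public

data Formula (σ : Schema) : Set where
  atom : (R : Fin (size σ)) → Vec ℕ (arity σ R) → Formula σ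
  eq   : ℕ → ℕ → Formula σ
  and  : Formula σ → Formula σ → Formula σ
  or   : Formula σ → Formula σ → Formula σ
  ex   : ℕ → Formula σ → Formula σ
  neg  : Formula σ → Formula σ
  svar : ℕ → ℕ → Formula σ                                   -- X(x)
  lfp  : ℕ → ℕ → Formula σ → ℕ → Formula σ                   -- [LFP_{X,x} φ](y)

module _ {σ : Schema} where

  del : ℕ → List ℕ → List ℕ
  del x []       = []
  del x (v ∷ vs) = if v ≡ᵇ x then del x vs else v ∷ del x vs

  fv : Formula σ → List ℕ
  fv (atom R xs)   = toList xs
  fv (eq x y)      = x ∷ y ∷ []
  fv (and φ ψ)     = fv φ ++ fv ψ
  fv (or φ ψ)      = fv φ ++ fv ψ
  fv (ex x φ)      = del x (fv φ)
  fv (neg φ)       = fv φ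
  fv (svar X x)    = x ∷ []
  fv (lfp X x φ y) = del x (fv φ) ++ (y ∷ [])

  fsv : Formula σ → List ℕ
  fsv (atom R xs)   = []
  fsv (eq x y)      = []
  fsv (and φ ψ)     = fsv φ ++ fsv ψ
  fsv (or φ ψ)      = fsv φ ++ fsv ψ
  fsv (ex x φ)      = fsv φ
  fsv (neg φ)       = fsv φ
  fsv (svar X x)    = X ∷ []
  fsv (lfp X x φ y) = del X (fsv φ)

  vars : Formula σ → List ℕ
  vars (atom R xs)   = toList xs
  vars (eq x y)      = x ∷ y ∷ []
  vars (and φ ψ)     = vars φ ++ vars ψ
  vars (or φ ψ)      = vars φ ++ vars ψ
  vars (ex x φ)      = x ∷ vars φ
  vars (neg φ)       = vars φ
  vars (svar X x)    = x ∷ []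
  vars (lfp X x φ y) = x ∷ y ∷ vars φ

  AtMostOne : List ℕ → Set
  AtMostOne l = ∀ {u v} → u ∈ l → v ∈ l → u ≡ v

  mutual
    data PosIn (X : ℕ) : Formula σ → Set where
      atom : ∀ {R xs} → PosIn X (atom R xs)
      eq   : ∀ {x y} → PosIn X (eq x y)
      and  : ∀ {φ ψ} → PosIn X φ → PosIn X ψ → PosIn X (and φ ψ)
      or   : ∀ {φ ψ} → PosIn X φ → PosIn X ψ → PosIn X (or φ ψ)
      ex   : ∀ {x φ} → PosIn X φ → PosIn X (ex x φ)
      neg  : ∀ {φ} → NegIn X φ → PosIn X (neg φ)
      svar : ∀ {Y x} → PosIn X (svar Y x)
      lfp-bound : ∀ {x φ y} → PosIn X (lfp X x φ y)
      lfp  : ∀ {Y x φ y} → Y ≢ X → PosIn X φ → PosIn X (lfp Y x φ y)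

    data NegIn (X : ℕ) : Formula σ → Set where
      atom : ∀ {R xs} → NegIn X (atom R xs)
      eq   : ∀ {x y} → NegIn X (eq x y)
      and  : ∀ {φ ψ} → NegIn X φ → NegIn X ψ → NegIn X (and φ ψ)
      or   : ∀ {φ ψ} → NegIn X φ → NegIn X ψ → NegIn X (or φ ψ)
      ex   : ∀ {x φ} → NegIn X φ → NegIn X (ex x φ)
      neg  : ∀ {φ} → PosIn X φ → NegIn X (neg φ)
      svar : ∀ {Y x} → Y ≢ X → NegIn X (svar Y x)
      lfp-bound : ∀ {x φ y} → NegIn X (lfp X x φ y)
      lfp  : ∀ {Y x φ y} → Y ≢ X → NegIn X φ → NegIn X (lfp Y x φ y)

  data UNFP : Formula σ → Set where
    atom : ∀ {R xs} → UNFP (atom R xs)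
    eq   : ∀ {x y} → UNFP (eq x y)
    and  : ∀ {φ ψ} → UNFP φ → UNFP ψ → UNFP (and φ ψ)
    or   : ∀ {φ ψ} → UNFP φ → UNFP ψ → UNFP (or φ ψ)
    ex   : ∀ {x φ} → UNFP φ → UNFP (ex x φ)
    neg  : ∀ {φ} → AtMostOne (fv φ) → UNFP φ → UNFP (neg φ)
    svar : ∀ {X x} → UNFP (svar X x)
    lfp  : ∀ {X x φ y} → PosIn X φ → (∀ {v} → v ∈ fv φ → v ≡ x) →
           UNFP φ → UNFP (lfp X x φ y)

  Sentence : Formula σ → Set
  Sentence φ = UNFP φ × fv φ ≡ [] × fsv φ ≡ []

  -- UN-normal form.  NFat ok φ : every ∃ in φ satisfies the condition,
  -- where ok = true means φ sits at the root or directly below an ∃.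
  NFat : Bool → Formula σ → Set
  NFat ok (atom R xs)   = ⊤
  NFat ok (eq x y)      = ⊤
  NFat ok (and φ ψ)     = NFat false φ × NFat false ψ
  NFat ok (or φ ψ)      = NFat false φ × NFat false ψ
  NFat ok (ex x φ)      = (ok ≡ true ⊎ AtMostOne (fv (ex x φ))) × NFat true φ
  NFat ok (neg φ)       = NFat false φ
  NFat ok (svar X x)    = ⊤
  NFat ok (lfp X x φ y) = NFat false φ

  UNNormalForm : Formula σ → Set
  UNNormalForm = NFat true

  rn : ℕ → ℕ → Formula σ → Formula σ
  rn x z (atom R xs)   = atom R (vmap r xs) where r = λ v → if v ≡ᵇ x then z else v
  rn x z (eq a b)      = eq (if a ≡ᵇ x then z else a) (if b ≡ᵇ x then z else b)
  rn x z (and φ ψ)     = and (rn x z φ) (rn x z ψ)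
  rn x z (or φ ψ)      = or (rn x z φ) (rn x z ψ)
  rn x z (ex y φ)      = if y ≡ᵇ x then ex y φ else ex y (rn x z φ)
  rn x z (neg φ)       = neg (rn x z φ)
  rn x z (svar X a)    = svar X (if a ≡ᵇ x then z else a)
  rn x z (lfp X y φ w) = lfp X y (if y ≡ᵇ x then φ else rn x z φ)
                                 (if w ≡ᵇ x then z else w)

  data Step : Formula σ → Formula σ → Set where
    ∧-ex  : ∀ {x φ ψ} → x ∉ fv φ → Step (and φ (ex x ψ)) (ex x (and φ ψ))
    ex-∧  : ∀ {x φ ψ} → x ∉ fv φ → Step (and (ex x ψ) φ) (ex x (and ψ φ))
    ∨-ex  : ∀ {x φ ψ} → x ∉ fv φ → Step (or φ (ex x ψ)) (ex x (or φ ψ))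
    ex-∨  : ∀ {x φ ψ} → x ∉ fv φ → Step (or (ex x ψ) φ) (ex x (or ψ φ))
    α-ex  : ∀ {x z φ} → z ∉ vars φ → Step (ex x φ) (ex z (rn x z φ))
    α-lfp : ∀ {X x z φ y} → z ∉ vars φ →
            Step (lfp X x φ y) (lfp X z (rn x z φ) y)
    and₁  : ∀ {φ φ' ψ} → Step φ φ' → Step (and φ ψ) (and φ' ψ)
    and₂  : ∀ {φ ψ ψ'} → Step ψ ψ' → Step (and φ ψ) (and φ ψ')
    or₁   : ∀ {φ φ' ψ} → Step φ φ' → Step (or φ ψ) (or φ' ψ)
    or₂   : ∀ {φ ψ ψ'} → Step ψ ψ' → Step (or φ ψ) (or φ ψ')
    ex    : ∀ {x φ φ'} → Step φ φ' → Step (ex x φ) (ex x φ')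
    neg   : ∀ {φ φ'} → Step φ φ' → Step (neg φ) (neg φ')
    lfp   : ∀ {X x φ φ' y} → Step φ φ' → Step (lfp X x φ y) (lfp X x φ' y)

  -- the rules are equivalences, so they may be used in both directions
  Rewrites : Formula σ → Formula σ → Set
  Rewrites = Star (SymClosure Step)

  Width : ℕ → Formula σ → Set
  Width k φ = Σ[ ψ ∈ Formula σ ] Rewrites φ ψ × UNNormalForm ψ ×
              (Σ[ vs ∈ List ℕ ] length vs ≤ k × (∀ {v} → v ∈ vars ψ → v ∈ vs))

-- Semantics (least fixpoints via the Knaster–Tarski intersection of all
-- prefixed points)

module _ {σ : Schema} (M : Structure σ) where

  private D = Carrier M

  upd : {A : Set₁} → (ℕ → A) → ℕ → A → ℕ → A
  upd ρ x a v = if v ≡ᵇ x then a else ρ v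

  upd₀ : (ℕ → D) → ℕ → D → ℕ → D
  upd₀ ρ x a v = if v ≡ᵇ x then a else ρ v

  Sat : Formula σ → (ℕ → D) → (ℕ → D → Set) → Set₁
  Sat (atom R xs)   ρ V = Lift _ (rel M R (vmap ρ xs))
  Sat (eq x y)      ρ V = Lift _ (ρ x ≡ ρ y)
  Sat (and φ ψ)     ρ V = Sat φ ρ V × Sat ψ ρ V
  Sat (or φ ψ)      ρ V = Sat φ ρ V ⊎ Sat ψ ρ V
  Sat (ex x φ)      ρ V = Σ[ d ∈ D ] Sat φ (upd₀ ρ x d) V
  Sat (neg φ)       ρ V = ¬ Sat φ ρ V
  Sat (svar X x)    ρ V = Lift _ (V X (ρ x))
  Sat (lfp X x φ y) ρ V =
    (P : D → Set) → (∀ d → Sat φ (upd₀ ρ x d) (upd V X P) → P d) → P (ρ y)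

  _⊨_ : Formula σ → Set₁
  _⊨_ φ = (ρ : ℕ → D) → Sat φ ρ (λ _ _ → ⊥)

module _ {σ : Schema} where

  -- ys : Fin m → N is a partial homomorphism from M with domain {xs i}
  PartialHom : (M N : Structure σ) {m : ℕ} →
               (Fin m → Carrier M) → (Fin m → Carrier N) → Set
  PartialHom M N {m} xs ys =
    (∀ i j → xs i ≡ xs j → ys i ≡ ys j) ×
    (∀ R (is : Vec (Fin m) (arity σ R)) →
       rel M R (vmap xs is) → rel N R (vmap ys is))

  -- forward condition, for finite sets whose size satisfies B
  Forth : (B : ℕ → Set) (M N : Structure σ) →
          (Carrier M → Carrier N → Set) → Set
  Forth B M N Z = ∀ a b → Z a b → ∀ m → B m → (xs : Fin m → Carrier M) →
    Σ[ ys ∈ (Fin m → Carrier N) ] PartialHom M N xs ys ×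
      (∀ i → xs i ≡ a → ys i ≡ b) × (∀ i → Z (xs i) (ys i))

  IsBisim : (B : ℕ → Set) (M N : Structure σ) →
            (Carrier M → Carrier N → Set) → Set
  IsBisim B M N Z = Forth B M N Z × Forth B N M (λ b a → Z a b)

  _≈UN[_]_ : Structure σ → ℕ → Structure σ → Set₁
  M ≈UN[ k ] N = Σ[ Z ∈ (Carrier M → Carrier N → Set) ]
                   IsBisim (λ m → m ≤ k) M N Z × (∃[ a ] ∃[ b ] Z a b)

  _≈UN_ : Structure σ → Structure σ → Set₁
  M ≈UN N = Σ[ Z ∈ (Carrier M → Carrier N → Set) ]
              IsBisim (λ _ → ⊤) M N Z × (∃[ a ] ∃[ b ] Z a b)

  Agree : Structure σ → Structure σ → Formula σ → Set₁
  Agree M N φ = (M ⊨ φ → N ⊨ φ) × (N ⊨ φ → M ⊨ φ)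

-- A bisimulation Z transfers truth from a ∈ M to every Z-partner b ∈ N.  Atoms and
-- equalities are carried by the partial homomorphisms supplied by forth.  A negated
-- formula has at most one free variable, so all of it sits at one pair of Z and the back
-- condition transfers the unnegated formula from N to M.  A least fixpoint in M is
-- contained in the prefixed point of elements all of whose Z-partners lie in the fixpoint
-- in N, since the fixpoint variable occurs only positively.  For width k, a normal form
-- consists of ∃-blocks over bodies with at most k variables, and one application of forth
-- to the values of all variables handles a whole body; without a width bound, forth is
-- applied to the finitely many witnesses used in the satisfaction proof.  The rewrite rules
-- defining the width preserve truth, well-formedness and free variables.

module Submission where

open import Defs
open import Level using (lift)
open import Data.Nat using (ℕ; _≡ᵇ_; _≥_; _≟_)
open import Data.Nat.Properties using (≡ᵇ⇒≡; ≡⇒≡ᵇ)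
open import Data.Bool using (true; false; if_then_else_; T)
open import Data.Unit using (tt)
open import Data.Empty using (⊥; ⊥-elim)
open import Data.Fin using (Fin)
import Data.Fin as Fin
open import Data.Vec using (Vec; toList) renaming (map to vmap; [] to v[]; _∷_ to _v∷_)
open import Data.Vec.Properties using (map-∘; toList-map)
open import Data.List using (List; []; _∷_; _++_; length; lookup)
open import Data.List.Membership.Propositional using (_∈_; _∉_)
open import Data.List.Membership.Propositional.Properties
  using (∈-++⁺ˡ; ∈-++⁺ʳ; ∈-++⁻; ∈-map⁺; ∈-map⁻)
open import Data.List.Membership.DecPropositional _≟_ using (_∈?_)
open import Data.List.Relation.Binary.Subset.Propositional using (_⊆_)
open import Data.List.Relation.Binary.Subset.Propositional.Properties
  using (xs⊆xs++ys; xs⊆ys++xs; ⊆[]⇒≡[])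
open import Data.List.Relation.Unary.Any using (here; there; index)
open import Data.List.Relation.Unary.Any.Properties using (lookup-index)
open import Data.Product using (Σ-syntax; ∃; ∃₂; ∃-syntax; _×_; _,_; proj₁; proj₂)
open import Data.Sum using (_⊎_; inj₁; inj₂)
open import Function using (_∘_; case_of_)
open import Function.Bundles using (_⇔_; mk⇔; Equivalence)
open import Function.Related.TypeIsomorphisms using (¬-cong-⇔)
open import Data.Product.Function.NonDependent.Propositional using (_×-⇔_)
open import Data.Sum.Function.Propositional using (_⊎-⇔_)
open import Function.Construct.Identity using (⇔-id)
open import Function.Construct.Symmetry using (⇔-sym)
open import Function.Construct.Composition using (_⇔-∘_)
open import Data.List.Relation.Binary.BagAndSetEquality using (_∼[_]_; set; ++-cong)
open import Relation.Nullary using (yes; no)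
open import Relation.Binary.PropositionalEquality
open import Relation.Binary.Construct.Closure.Symmetric using (fwd; bwd)
open import Relation.Binary.Construct.Closure.ReflexiveTransitive using (ε; _◅_)

open Equivalence using (to; from)

if-≡ᵇ-≡ : ∀ {ℓ} {A : Set ℓ} {u x} (a b : A) → u ≡ x → (if u ≡ᵇ x then a else b) ≡ a
if-≡ᵇ-≡ {u = u} a b refl with u ≡ᵇ u in e
... | true  = refl
... | false = ⊥-elim (subst T e (≡⇒≡ᵇ u u refl))

if-≡ᵇ-≢ : ∀ {ℓ} {A : Set ℓ} {u x} (a b : A) → u ≢ x → (if u ≡ᵇ x then a else b) ≡ b
if-≡ᵇ-≢ {u = u} {x} a b u≢x with u ≡ᵇ x in e
... | false = refl
... | true  = ⊥-elim (u≢x (≡ᵇ⇒≡ u x (subst T (sym e) tt)))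

∉∧∈⇒≢ : ∀ {z v : ℕ} {l} → z ∉ l → v ∈ l → z ≢ v
∉∧∈⇒≢ z∉ v∈ refl = z∉ v∈

vmap-cong-∈ : ∀ {A : Set} {n} (f g : ℕ → A) (xs : Vec ℕ n) →
              (∀ {u} → u ∈ toList xs → f u ≡ g u) → vmap f xs ≡ vmap g xs
vmap-cong-∈ f g v[]        f≗g = refl
vmap-cong-∈ f g (x v∷ xs) f≗g = cong₂ _v∷_ (f≗g (here refl)) (vmap-cong-∈ f g xs (f≗g ∘ there))

module _ {σ : Schema} where

  -- del does not depend on σ, which therefore has to be given explicitly.

  ∈-del⁻ : ∀ {x u} l → u ∈ del {σ} x l → u ∈ l × u ≢ x
  ∈-del⁻ {x} (v ∷ l) u∈ with v ≟ x
  ... | yes v≡x rewrite if-≡ᵇ-≡ (del {σ} x l) (v ∷ del {σ} x l) v≡x =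
    let (u∈l , u≢x) = ∈-del⁻ l u∈ in there u∈l , u≢x
  ... | no v≢x rewrite if-≡ᵇ-≢ (del {σ} x l) (v ∷ del {σ} x l) v≢x with u∈
  ...   | here refl = here refl , v≢x
  ...   | there u∈′ = let (u∈l , u≢x) = ∈-del⁻ l u∈′ in there u∈l , u≢x

  ∈-del⁺ : ∀ {x u} l → u ∈ l → u ≢ x → u ∈ del {σ} x l
  ∈-del⁺ {x} (v ∷ l) u∈ u≢x with v ≟ x | u∈
  ... | yes refl | here refl = ⊥-elim (u≢x refl)
  ... | yes v≡x  | there u∈l rewrite if-≡ᵇ-≡ (del {σ} x l) (v ∷ del {σ} x l) v≡x =
    ∈-del⁺ l u∈l u≢x
  ... | no v≢x   | here refl rewrite if-≡ᵇ-≢ (del {σ} x l) (v ∷ del {σ} x l) v≢x = here refl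
  ... | no v≢x   | there u∈l rewrite if-≡ᵇ-≢ (del {σ} x l) (v ∷ del {σ} x l) v≢x =
    there (∈-del⁺ l u∈l u≢x)

  fv⊆vars : (φ : Formula σ) → fv φ ⊆ vars φ
  fv⊆vars (atom R xs)   u∈ = u∈
  fv⊆vars (eq x y)      u∈ = u∈
  fv⊆vars (and φ ψ)     u∈ with ∈-++⁻ (fv φ) u∈
  ... | inj₁ u∈φ = ∈-++⁺ˡ (fv⊆vars φ u∈φ)
  ... | inj₂ u∈ψ = ∈-++⁺ʳ (vars φ) (fv⊆vars ψ u∈ψ)
  fv⊆vars (or φ ψ)      u∈ with ∈-++⁻ (fv φ) u∈
  ... | inj₁ u∈φ = ∈-++⁺ˡ (fv⊆vars φ u∈φ)
  ... | inj₂ u∈ψ = ∈-++⁺ʳ (vars φ) (fv⊆vars ψ u∈ψ)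
  fv⊆vars (ex x φ)      u∈ = there (fv⊆vars φ (proj₁ (∈-del⁻ (fv φ) u∈)))
  fv⊆vars (neg φ)       u∈ = fv⊆vars φ u∈
  fv⊆vars (svar X x)    u∈ = u∈
  fv⊆vars (lfp X x φ y) u∈ with ∈-++⁻ (del {σ} x (fv φ)) u∈
  ... | inj₁ u∈φ        = there (there (fv⊆vars φ (proj₁ (∈-del⁻ (fv φ) u∈φ))))
  ... | inj₂ (here refl) = there (here refl)

  rnVar : ℕ → ℕ → ℕ → ℕ
  rnVar x z u = if u ≡ᵇ x then z else u

  rnVar-≡ : ∀ x z → rnVar x z x ≡ z
  rnVar-≡ x z = if-≡ᵇ-≡ {u = x} z x refl

  rnVar-≢ : ∀ {x} z {u} → u ≢ x → rnVar x z u ≡ u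
  rnVar-≢ z {u} = if-≡ᵇ-≢ z u

  rnVar-avoids : ∀ x {z y} u → z ≢ y → u ≢ y → rnVar x z u ≢ y
  rnVar-avoids x {z} u z≢y u≢y with u ≟ x
  ... | yes refl = subst (_≢ _) (sym (rnVar-≡ x z)) z≢y
  ... | no u≢x   = subst (_≢ _) (sym (rnVar-≢ z u≢x)) u≢y

  rnVar-injective : ∀ x {z u w} → z ≢ u → z ≢ w → rnVar x z u ≡ rnVar x z w → u ≡ w
  rnVar-injective x {z} {u} {w} z≢u z≢w same with u ≟ x | w ≟ x
  ... | yes refl | yes refl = refl
  ... | yes refl | no w≢x   = ⊥-elim (z≢w (trans (sym (rnVar-≡ x z)) (trans same (rnVar-≢ z w≢x))))
  ... | no u≢x   | yes refl = ⊥-elim (z≢u (trans (sym (rnVar-≡ x z)) (trans (sym same) (rnVar-≢ z u≢x))))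
  ... | no u≢x   | no w≢x   = trans (sym (rnVar-≢ z u≢x)) (trans same (rnVar-≢ z w≢x))

  rn-ex-bound : ∀ x z (φ : Formula σ) → rn x z (ex x φ) ≡ ex x φ
  rn-ex-bound x z φ = if-≡ᵇ-≡ {u = x} (ex x φ) (ex x (rn x z φ)) refl

  rn-ex-free : ∀ {x y} z (φ : Formula σ) → y ≢ x → rn x z (ex y φ) ≡ ex y (rn x z φ)
  rn-ex-free {x} {y} z φ = if-≡ᵇ-≢ (ex y φ) (ex y (rn x z φ))

  ∈-rnVar-del : ∀ x z l {u} → u ∈ del {σ} x l → rnVar x z u ∈ del {σ} x l
  ∈-rnVar-del x z l u∈ = subst (_∈ del {σ} x l) (sym (rnVar-≢ z (proj₂ (∈-del⁻ l u∈)))) u∈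

  mutual
    fv-rn⁺ : ∀ x z (φ : Formula σ) → z ∉ vars φ →
             ∀ {u} → u ∈ fv φ → rnVar x z u ∈ fv (rn x z φ)
    fv-rn⁺ x z (atom R us) z∉ u∈ = subst (_ ∈_) (sym (toList-map (rnVar x z) us)) (∈-map⁺ (rnVar x z) u∈)
    fv-rn⁺ x z (eq a b) z∉ (here refl)         = here refl
    fv-rn⁺ x z (eq a b) z∉ (there (here refl)) = there (here refl)
    fv-rn⁺ x z (and φ ψ) z∉ u∈ with ∈-++⁻ (fv φ) u∈
    ... | inj₁ u∈φ = ∈-++⁺ˡ (fv-rn⁺ x z φ (z∉ ∘ xs⊆xs++ys _ _) u∈φ)
    ... | inj₂ u∈ψ = ∈-++⁺ʳ (fv (rn x z φ)) (fv-rn⁺ x z ψ (z∉ ∘ xs⊆ys++xs _ (vars φ)) u∈ψ)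
    fv-rn⁺ x z (or φ ψ) z∉ u∈ with ∈-++⁻ (fv φ) u∈
    ... | inj₁ u∈φ = ∈-++⁺ˡ (fv-rn⁺ x z φ (z∉ ∘ xs⊆xs++ys _ _) u∈φ)
    ... | inj₂ u∈ψ = ∈-++⁺ʳ (fv (rn x z φ)) (fv-rn⁺ x z ψ (z∉ ∘ xs⊆ys++xs _ (vars φ)) u∈ψ)
    fv-rn⁺ x z (neg φ) z∉ u∈ = fv-rn⁺ x z φ z∉ u∈
    fv-rn⁺ x z (svar X a) z∉ (here refl) = here refl
    fv-rn⁺ x z (ex y φ) z∉ u∈ with y ≟ x
    ... | yes refl rewrite rn-ex-bound y z φ = ∈-rnVar-del y z (fv φ) u∈
    ... | no y≢x rewrite rn-ex-free z φ y≢x =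
      fv-rn-under⁺ x z y φ y≢x (∉∧∈⇒≢ z∉ (here refl)) (z∉ ∘ there) u∈
    fv-rn⁺ x z (lfp X y φ w) z∉ u∈ with y ≟ x | ∈-++⁻ (del {σ} y (fv φ)) u∈
    ... | yes refl | inj₁ u∈φ rewrite if-≡ᵇ-≡ {u = y} φ (rn y z φ) refl =
      ∈-++⁺ˡ (∈-rnVar-del y z (fv φ) u∈φ)
    ... | yes refl | inj₂ (here refl) rewrite if-≡ᵇ-≡ {u = y} φ (rn y z φ) refl =
      ∈-++⁺ʳ (del {σ} y (fv φ)) (here refl)
    ... | no y≢x | inj₁ u∈φ rewrite if-≡ᵇ-≢ φ (rn x z φ) y≢x =
      ∈-++⁺ˡ (fv-rn-under⁺ x z y φ y≢x (∉∧∈⇒≢ z∉ (here refl)) (z∉ ∘ there ∘ there) u∈φ)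
    ... | no y≢x | inj₂ (here refl) rewrite if-≡ᵇ-≢ φ (rn x z φ) y≢x =
      ∈-++⁺ʳ (del {σ} y (fv (rn x z φ))) (here refl)

    fv-rn-under⁺ : ∀ x z y (φ : Formula σ) → y ≢ x → z ≢ y → z ∉ vars φ →
                   ∀ {u} → u ∈ del {σ} y (fv φ) → rnVar x z u ∈ del {σ} y (fv (rn x z φ))
    fv-rn-under⁺ x z y φ y≢x z≢y z∉ {u} u∈ =
      let (u∈φ , u≢y) = ∈-del⁻ (fv φ) u∈ in
      ∈-del⁺ (fv (rn x z φ)) (fv-rn⁺ x z φ z∉ u∈φ) (rnVar-avoids x u z≢y u≢y)

  mutual
    fv-rn⁻ : ∀ x z (φ : Formula σ) {u} → u ∈ fv (rn x z φ) → ∃ λ w → w ∈ fv φ × u ≡ rnVar x z w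
    fv-rn⁻ x z (atom R us) u∈ = ∈-map⁻ (rnVar x z) (subst (_ ∈_) (toList-map (rnVar x z) us) u∈)
    fv-rn⁻ x z (eq a b) (here refl)         = a , here refl , refl
    fv-rn⁻ x z (eq a b) (there (here refl)) = b , there (here refl) , refl
    fv-rn⁻ x z (and φ ψ) u∈ with ∈-++⁻ (fv (rn x z φ)) u∈
    ... | inj₁ u∈φ = let (w , w∈ , u≡) = fv-rn⁻ x z φ u∈φ in w , ∈-++⁺ˡ w∈ , u≡
    ... | inj₂ u∈ψ = let (w , w∈ , u≡) = fv-rn⁻ x z ψ u∈ψ in w , ∈-++⁺ʳ (fv φ) w∈ , u≡
    fv-rn⁻ x z (or φ ψ) u∈ with ∈-++⁻ (fv (rn x z φ)) u∈
    ... | inj₁ u∈φ = let (w , w∈ , u≡) = fv-rn⁻ x z φ u∈φ in w , ∈-++⁺ˡ w∈ , u≡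
    ... | inj₂ u∈ψ = let (w , w∈ , u≡) = fv-rn⁻ x z ψ u∈ψ in w , ∈-++⁺ʳ (fv φ) w∈ , u≡
    fv-rn⁻ x z (neg φ) u∈ = fv-rn⁻ x z φ u∈
    fv-rn⁻ x z (svar X a) (here refl) = a , here refl , refl
    fv-rn⁻ x z (ex y φ) {u} u∈ with y ≟ x
    ... | yes refl rewrite rn-ex-bound y z φ =
      u , u∈ , sym (rnVar-≢ z (proj₂ (∈-del⁻ (fv φ) u∈)))
    ... | no y≢x rewrite rn-ex-free z φ y≢x = fv-rn-under⁻ x z y φ y≢x u∈
    fv-rn⁻ x z (lfp X y φ w) {u} u∈ with y ≟ x
    ... | yes refl rewrite if-≡ᵇ-≡ {u = y} φ (rn y z φ) refl with ∈-++⁻ (del {σ} y (fv φ)) u∈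
    ...   | inj₁ u∈φ        = u , ∈-++⁺ˡ u∈φ , sym (rnVar-≢ z (proj₂ (∈-del⁻ (fv φ) u∈φ)))
    ...   | inj₂ (here refl) = w , ∈-++⁺ʳ (del {σ} y (fv φ)) (here refl) , refl
    fv-rn⁻ x z (lfp X y φ w) {u} u∈ | no y≢x rewrite if-≡ᵇ-≢ φ (rn x z φ) y≢x
      with ∈-++⁻ (del {σ} y (fv (rn x z φ))) u∈
    ...   | inj₁ u∈φ =
      let (v , v∈ , u≡) = fv-rn-under⁻ x z y φ y≢x u∈φ in v , ∈-++⁺ˡ v∈ , u≡
    ...   | inj₂ (here refl) = w , ∈-++⁺ʳ (del {σ} y (fv φ)) (here refl) , refl

    fv-rn-under⁻ : ∀ x z y (φ : Formula σ) → y ≢ x →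
                   ∀ {u} → u ∈ del {σ} y (fv (rn x z φ)) →
                   ∃ λ w → w ∈ del {σ} y (fv φ) × u ≡ rnVar x z w
    fv-rn-under⁻ x z y φ y≢x u∈ with ∈-del⁻ (fv (rn x z φ)) u∈
    ... | u∈φ , u≢y with fv-rn⁻ x z φ u∈φ
    ...   | w , w∈ , refl = w , ∈-del⁺ (fv φ) w∈ (λ { refl → u≢y (rnVar-≢ z y≢x) }) , refl

  mutual
    PosIn-rn : ∀ x z X (φ : Formula σ) → PosIn X φ ⇔ PosIn X (rn x z φ)
    PosIn-rn x z X (atom R us) = mk⇔ (λ _ → atom) (λ _ → atom)
    PosIn-rn x z X (eq a b)    = mk⇔ (λ _ → eq) (λ _ → eq)
    PosIn-rn x z X (and φ ψ)   = let IHφ = PosIn-rn x z X φ ; IHψ = PosIn-rn x z X ψ in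
      mk⇔ (λ { (and p q) → and (to IHφ p) (to IHψ q) }) (λ { (and p q) → and (from IHφ p) (from IHψ q) })
    PosIn-rn x z X (or φ ψ)    = let IHφ = PosIn-rn x z X φ ; IHψ = PosIn-rn x z X ψ in
      mk⇔ (λ { (or p q) → or (to IHφ p) (to IHψ q) }) (λ { (or p q) → or (from IHφ p) (from IHψ q) })
    PosIn-rn x z X (neg φ)     = mk⇔ (λ { (neg n) → neg (to (NegIn-rn x z X φ) n) })
                                     (λ { (neg n) → neg (from (NegIn-rn x z X φ) n) })
    PosIn-rn x z X (svar Y a)  = mk⇔ (λ _ → svar) (λ _ → svar)
    PosIn-rn x z X (ex y φ) with y ≟ x
    ... | yes refl rewrite rn-ex-bound y z φ = mk⇔ (λ p → p) (λ p → p)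
    ... | no y≢x rewrite rn-ex-free z φ y≢x =
      mk⇔ (λ { (ex p) → ex (to (PosIn-rn x z X φ) p) }) (λ { (ex p) → ex (from (PosIn-rn x z X φ) p) })
    PosIn-rn x z X (lfp Y y φ w) with y ≟ x
    ... | yes refl rewrite if-≡ᵇ-≡ {u = y} φ (rn y z φ) refl =
      mk⇔ (λ { lfp-bound → lfp-bound ; (lfp Y≢X p) → lfp Y≢X p })
          (λ { lfp-bound → lfp-bound ; (lfp Y≢X p) → lfp Y≢X p })
    ... | no y≢x rewrite if-≡ᵇ-≢ φ (rn x z φ) y≢x =
      mk⇔ (λ { lfp-bound → lfp-bound ; (lfp Y≢X p) → lfp Y≢X (to (PosIn-rn x z X φ) p) })
          (λ { lfp-bound → lfp-bound ; (lfp Y≢X p) → lfp Y≢X (from (PosIn-rn x z X φ) p) })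

    NegIn-rn : ∀ x z X (φ : Formula σ) → NegIn X φ ⇔ NegIn X (rn x z φ)
    NegIn-rn x z X (atom R us) = mk⇔ (λ _ → atom) (λ _ → atom)
    NegIn-rn x z X (eq a b)    = mk⇔ (λ _ → eq) (λ _ → eq)
    NegIn-rn x z X (and φ ψ)   = let IHφ = NegIn-rn x z X φ ; IHψ = NegIn-rn x z X ψ in
      mk⇔ (λ { (and n m) → and (to IHφ n) (to IHψ m) }) (λ { (and n m) → and (from IHφ n) (from IHψ m) })
    NegIn-rn x z X (or φ ψ)    = let IHφ = NegIn-rn x z X φ ; IHψ = NegIn-rn x z X ψ in
      mk⇔ (λ { (or n m) → or (to IHφ n) (to IHψ m) }) (λ { (or n m) → or (from IHφ n) (from IHψ m) })
    NegIn-rn x z X (neg φ)     = mk⇔ (λ { (neg p) → neg (to (PosIn-rn x z X φ) p) })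
                                     (λ { (neg p) → neg (from (PosIn-rn x z X φ) p) })
    NegIn-rn x z X (svar Y a)  = mk⇔ (λ { (svar Y≢X) → svar Y≢X }) (λ { (svar Y≢X) → svar Y≢X })
    NegIn-rn x z X (ex y φ) with y ≟ x
    ... | yes refl rewrite rn-ex-bound y z φ = mk⇔ (λ n → n) (λ n → n)
    ... | no y≢x rewrite rn-ex-free z φ y≢x =
      mk⇔ (λ { (ex n) → ex (to (NegIn-rn x z X φ) n) }) (λ { (ex n) → ex (from (NegIn-rn x z X φ) n) })
    NegIn-rn x z X (lfp Y y φ w) with y ≟ x
    ... | yes refl rewrite if-≡ᵇ-≡ {u = y} φ (rn y z φ) refl =
      mk⇔ (λ { lfp-bound → lfp-bound ; (lfp Y≢X n) → lfp Y≢X n })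
          (λ { lfp-bound → lfp-bound ; (lfp Y≢X n) → lfp Y≢X n })
    ... | no y≢x rewrite if-≡ᵇ-≢ φ (rn x z φ) y≢x =
      mk⇔ (λ { lfp-bound → lfp-bound ; (lfp Y≢X n) → lfp Y≢X (to (NegIn-rn x z X φ) n) })
          (λ { lfp-bound → lfp-bound ; (lfp Y≢X n) → lfp Y≢X (from (NegIn-rn x z X φ) n) })

  AtMostOne-rn : ∀ x z (φ : Formula σ) → z ∉ vars φ →
                 AtMostOne {σ} (fv φ) ⇔ AtMostOne {σ} (fv (rn x z φ))
  AtMostOne-rn x z φ z∉ = mk⇔ to′ from′
    where
    to′ : AtMostOne {σ} (fv φ) → AtMostOne {σ} (fv (rn x z φ))
    to′ one u∈ v∈ with fv-rn⁻ x z φ u∈ | fv-rn⁻ x z φ v∈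
    ... | _ , u′∈ , refl | _ , v′∈ , refl = cong (rnVar x z) (one u′∈ v′∈)
    from′ : AtMostOne {σ} (fv (rn x z φ)) → AtMostOne {σ} (fv φ)
    from′ one u∈ v∈ =
      rnVar-injective x (∉∧∈⇒≢ z∉ (fv⊆vars φ u∈)) (∉∧∈⇒≢ z∉ (fv⊆vars φ v∈))
        (one (fv-rn⁺ x z φ z∉ u∈) (fv-rn⁺ x z φ z∉ v∈))

  OnlyFree : ℕ → Formula σ → Set
  OnlyFree y φ = ∀ {v} → v ∈ fv φ → v ≡ y

  OnlyFree-rn : ∀ x z y (φ : Formula σ) → z ∉ vars φ → (y ≢ x → z ≢ y) →
                ∀ {t} → rnVar x z y ≡ t → OnlyFree y φ ⇔ OnlyFree t (rn x z φ)
  OnlyFree-rn x z y φ z∉ z≢y refl = mk⇔ to′ from′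
    where
    to′ : OnlyFree y φ → OnlyFree (rnVar x z y) (rn x z φ)
    to′ bound v∈ with fv-rn⁻ x z φ v∈
    ... | _ , w∈ , refl = cong (rnVar x z) (bound w∈)
    from′ : OnlyFree (rnVar x z y) (rn x z φ) → OnlyFree y φ
    from′ bound {w} w∈ with bound (fv-rn⁺ x z φ z∉ w∈) | w ≟ x | y ≟ x
    ... | r≡r | yes refl | yes refl = refl
    ... | r≡r | yes refl | no y≢x   =
      ⊥-elim (z≢y y≢x (trans (sym (rnVar-≡ w z)) (trans r≡r (rnVar-≢ z y≢x))))
    ... | r≡r | no w≢x   | yes refl =
      ⊥-elim (∉∧∈⇒≢ z∉ (fv⊆vars φ w∈)
                (sym (trans (sym (rnVar-≢ z w≢x)) (trans r≡r (rnVar-≡ y z)))))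
    ... | r≡r | no w≢x   | no y≢x   = trans (sym (rnVar-≢ z w≢x)) (trans r≡r (rnVar-≢ z y≢x))

  UNFP-rn : ∀ x z (φ : Formula σ) → z ∉ vars φ → UNFP φ ⇔ UNFP (rn x z φ)
  UNFP-rn x z (atom R us) z∉ = mk⇔ (λ _ → atom) (λ _ → atom)
  UNFP-rn x z (eq a b)    z∉ = mk⇔ (λ _ → eq) (λ _ → eq)
  UNFP-rn x z (and φ ψ)   z∉ =
    let IHφ = UNFP-rn x z φ (z∉ ∘ xs⊆xs++ys _ _) ; IHψ = UNFP-rn x z ψ (z∉ ∘ xs⊆ys++xs _ (vars φ)) in
    mk⇔ (λ { (and p q) → and (to IHφ p) (to IHψ q) }) (λ { (and p q) → and (from IHφ p) (from IHψ q) })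
  UNFP-rn x z (or φ ψ)    z∉ =
    let IHφ = UNFP-rn x z φ (z∉ ∘ xs⊆xs++ys _ _) ; IHψ = UNFP-rn x z ψ (z∉ ∘ xs⊆ys++xs _ (vars φ)) in
    mk⇔ (λ { (or p q) → or (to IHφ p) (to IHψ q) }) (λ { (or p q) → or (from IHφ p) (from IHψ q) })
  UNFP-rn x z (neg φ)     z∉ =
    let IH = UNFP-rn x z φ z∉ ; one = AtMostOne-rn x z φ z∉ in
    mk⇔ (λ { (neg o p) → neg (to one o) (to IH p) }) (λ { (neg o p) → neg (from one o) (from IH p) })
  UNFP-rn x z (svar X a)  z∉ = mk⇔ (λ _ → svar) (λ _ → svar)
  UNFP-rn x z (ex y φ) z∉ with y ≟ x
  ... | yes refl rewrite rn-ex-bound y z φ = mk⇔ (λ p → p) (λ p → p)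
  ... | no y≢x rewrite rn-ex-free z φ y≢x =
    let IH = UNFP-rn x z φ (z∉ ∘ there) in
    mk⇔ (λ { (ex p) → ex (to IH p) }) (λ { (ex p) → ex (from IH p) })
  UNFP-rn x z (lfp X y φ w) z∉ with y ≟ x
  ... | yes refl rewrite if-≡ᵇ-≡ {u = y} φ (rn y z φ) refl =
    mk⇔ (λ { (lfp pos only p) → lfp pos only p }) (λ { (lfp pos only p) → lfp pos only p })
  ... | no y≢x rewrite if-≡ᵇ-≢ φ (rn x z φ) y≢x =
    mk⇔ (λ { (lfp pos only p) → lfp (to pol pos) (to free only) (to IH p) })
        (λ { (lfp pos only p) → lfp (from pol pos) (from free only) (from IH p) })
    where
    z∉φ = z∉ ∘ there ∘ there
    IH = UNFP-rn x z φ z∉φ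
    pol = PosIn-rn x z X φ
    free = OnlyFree-rn x z y φ z∉φ (λ _ → ∉∧∈⇒≢ z∉ (here refl)) (rnVar-≢ z y≢x)

  del-++ˡ : ∀ x l₁ l₂ → x ∉ l₁ → (l₁ ++ del {σ} x l₂) ∼[ set ] del {σ} x (l₁ ++ l₂)
  del-++ˡ x l₁ l₂ x∉ = mk⇔ to′ from′
    where
    to′ : ∀ {u} → u ∈ l₁ ++ del {σ} x l₂ → u ∈ del {σ} x (l₁ ++ l₂)
    to′ u∈ with ∈-++⁻ l₁ u∈
    ... | inj₁ u∈₁ = ∈-del⁺ (l₁ ++ l₂) (∈-++⁺ˡ u∈₁) (≢-sym (∉∧∈⇒≢ x∉ u∈₁))
    ... | inj₂ u∈₂ = let (u∈l₂ , u≢x) = ∈-del⁻ l₂ u∈₂ in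
                     ∈-del⁺ (l₁ ++ l₂) (∈-++⁺ʳ l₁ u∈l₂) u≢x
    from′ : ∀ {u} → u ∈ del {σ} x (l₁ ++ l₂) → u ∈ l₁ ++ del {σ} x l₂
    from′ u∈ with ∈-del⁻ (l₁ ++ l₂) u∈
    ... | u∈l , u≢x with ∈-++⁻ l₁ u∈l
    ...   | inj₁ u∈₁ = ∈-++⁺ˡ u∈₁
    ...   | inj₂ u∈₂ = ∈-++⁺ʳ l₁ (∈-del⁺ l₂ u∈₂ u≢x)

  del-++ʳ : ∀ x l₁ l₂ → x ∉ l₂ → (del {σ} x l₁ ++ l₂) ∼[ set ] del {σ} x (l₁ ++ l₂)
  del-++ʳ x l₁ l₂ x∉ = mk⇔ to′ from′
    where
    to′ : ∀ {u} → u ∈ del {σ} x l₁ ++ l₂ → u ∈ del {σ} x (l₁ ++ l₂)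
    to′ u∈ with ∈-++⁻ (del {σ} x l₁) u∈
    ... | inj₁ u∈₁ = let (u∈l₁ , u≢x) = ∈-del⁻ l₁ u∈₁ in
                     ∈-del⁺ (l₁ ++ l₂) (∈-++⁺ˡ u∈l₁) u≢x
    ... | inj₂ u∈₂ = ∈-del⁺ (l₁ ++ l₂) (∈-++⁺ʳ l₁ u∈₂) (≢-sym (∉∧∈⇒≢ x∉ u∈₂))
    from′ : ∀ {u} → u ∈ del {σ} x (l₁ ++ l₂) → u ∈ del {σ} x l₁ ++ l₂
    from′ u∈ with ∈-del⁻ (l₁ ++ l₂) u∈
    ... | u∈l , u≢x with ∈-++⁻ l₁ u∈l
    ...   | inj₁ u∈₁ = ∈-++⁺ˡ (∈-del⁺ l₁ u∈₁ u≢x)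
    ...   | inj₂ u∈₂ = ∈-++⁺ʳ (del {σ} x l₁) u∈₂

  del-cong : ∀ x {l l′} → l ∼[ set ] l′ → del {σ} x l ∼[ set ] del {σ} x l′
  del-cong x {l} {l′} l∼l′ =
    mk⇔ (λ u∈ → let (u∈l , u≢x) = ∈-del⁻ l u∈ in ∈-del⁺ l′ (to l∼l′ u∈l) u≢x)
        (λ u∈ → let (u∈l′ , u≢x) = ∈-del⁻ l′ u∈ in ∈-del⁺ l (from l∼l′ u∈l′) u≢x)

  del-rn : ∀ x z (φ : Formula σ) → z ∉ vars φ → del {σ} x (fv φ) ∼[ set ] del {σ} z (fv (rn x z φ))
  del-rn x z φ z∉ = mk⇔ to′ from′
    where
    to′ : ∀ {u} → u ∈ del {σ} x (fv φ) → u ∈ del {σ} z (fv (rn x z φ))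
    to′ u∈ with ∈-del⁻ (fv φ) u∈
    ... | u∈φ , u≢x =
      ∈-del⁺ (fv (rn x z φ)) (subst (_∈ fv (rn x z φ)) (rnVar-≢ z u≢x) (fv-rn⁺ x z φ z∉ u∈φ))
        (≢-sym (∉∧∈⇒≢ z∉ (fv⊆vars φ u∈φ)))
    from′ : ∀ {u} → u ∈ del {σ} z (fv (rn x z φ)) → u ∈ del {σ} x (fv φ)
    from′ u∈ with ∈-del⁻ (fv (rn x z φ)) u∈
    ... | u∈rn , u≢z with fv-rn⁻ x z φ u∈rn
    ...   | w , w∈ , refl with w ≟ x
    ...     | yes refl = ⊥-elim (u≢z (rnVar-≡ w z))
    ...     | no w≢x   = subst (_∈ del {σ} x (fv φ)) (sym (rnVar-≢ z w≢x)) (∈-del⁺ (fv φ) w∈ w≢x)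

  Step-fv : ∀ {φ φ′ : Formula σ} → Step φ φ′ → fv φ ∼[ set ] fv φ′
  Step-fv (∧-ex {x} {φ} {ψ} x∉) = del-++ˡ x (fv φ) (fv ψ) x∉
  Step-fv (ex-∧ {x} {φ} {ψ} x∉) = del-++ʳ x (fv ψ) (fv φ) x∉
  Step-fv (∨-ex {x} {φ} {ψ} x∉) = del-++ˡ x (fv φ) (fv ψ) x∉
  Step-fv (ex-∨ {x} {φ} {ψ} x∉) = del-++ʳ x (fv ψ) (fv φ) x∉
  Step-fv (α-ex {x} {z} {φ} z∉) = del-rn x z φ z∉
  Step-fv (α-lfp {x = x} {z} {φ} {y} z∉) = ++-cong (del-rn x z φ z∉) (⇔-id _)
  Step-fv (and₁ s)              = ++-cong (Step-fv s) (⇔-id _)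
  Step-fv (and₂ {φ} s)          = ++-cong {xs₁ = fv φ} (⇔-id _) (Step-fv s)
  Step-fv (or₁ s)               = ++-cong (Step-fv s) (⇔-id _)
  Step-fv (or₂ {φ} s)           = ++-cong {xs₁ = fv φ} (⇔-id _) (Step-fv s)
  Step-fv (ex {x} s)            = del-cong x (Step-fv s)
  Step-fv (neg s)               = Step-fv s
  Step-fv (lfp {x = x} s)       = ++-cong (del-cong x (Step-fv s)) (⇔-id _)

  Step-polarity : ∀ {φ φ′ : Formula σ} → Step φ φ′ → ∀ X →
                  (PosIn X φ ⇔ PosIn X φ′) × (NegIn X φ ⇔ NegIn X φ′)
  Step-polarity (∧-ex _) X =
    mk⇔ (λ { (and p (ex q)) → ex (and p q) }) (λ { (ex (and p q)) → and p (ex q) }) ,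
    mk⇔ (λ { (and p (ex q)) → ex (and p q) }) (λ { (ex (and p q)) → and p (ex q) })
  Step-polarity (ex-∧ _) X =
    mk⇔ (λ { (and (ex q) p) → ex (and q p) }) (λ { (ex (and q p)) → and (ex q) p }) ,
    mk⇔ (λ { (and (ex q) p) → ex (and q p) }) (λ { (ex (and q p)) → and (ex q) p })
  Step-polarity (∨-ex _) X =
    mk⇔ (λ { (or p (ex q)) → ex (or p q) }) (λ { (ex (or p q)) → or p (ex q) }) ,
    mk⇔ (λ { (or p (ex q)) → ex (or p q) }) (λ { (ex (or p q)) → or p (ex q) })
  Step-polarity (ex-∨ _) X =
    mk⇔ (λ { (or (ex q) p) → ex (or q p) }) (λ { (ex (or q p)) → or (ex q) p }) ,
    mk⇔ (λ { (or (ex q) p) → ex (or q p) }) (λ { (ex (or q p)) → or (ex q) p })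
  Step-polarity (α-ex {x} {z} {φ} _) X =
    mk⇔ (λ { (ex p) → ex (to (PosIn-rn x z X φ) p) }) (λ { (ex p) → ex (from (PosIn-rn x z X φ) p) }) ,
    mk⇔ (λ { (ex n) → ex (to (NegIn-rn x z X φ) n) }) (λ { (ex n) → ex (from (NegIn-rn x z X φ) n) })
  Step-polarity (α-lfp {x = x} {z} {φ} _) X =
    mk⇔ (λ { lfp-bound → lfp-bound ; (lfp Y≢X p) → lfp Y≢X (to (PosIn-rn x z X φ) p) })
        (λ { lfp-bound → lfp-bound ; (lfp Y≢X p) → lfp Y≢X (from (PosIn-rn x z X φ) p) }) ,
    mk⇔ (λ { lfp-bound → lfp-bound ; (lfp Y≢X n) → lfp Y≢X (to (NegIn-rn x z X φ) n) })
        (λ { lfp-bound → lfp-bound ; (lfp Y≢X n) → lfp Y≢X (from (NegIn-rn x z X φ) n) })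
  Step-polarity (and₁ s) X = let (pos , neg′) = Step-polarity s X in
    mk⇔ (λ { (and p q) → and (to pos p) q }) (λ { (and p q) → and (from pos p) q }) ,
    mk⇔ (λ { (and p q) → and (to neg′ p) q }) (λ { (and p q) → and (from neg′ p) q })
  Step-polarity (and₂ s) X = let (pos , neg′) = Step-polarity s X in
    mk⇔ (λ { (and p q) → and p (to pos q) }) (λ { (and p q) → and p (from pos q) }) ,
    mk⇔ (λ { (and p q) → and p (to neg′ q) }) (λ { (and p q) → and p (from neg′ q) })
  Step-polarity (or₁ s) X = let (pos , neg′) = Step-polarity s X in
    mk⇔ (λ { (or p q) → or (to pos p) q }) (λ { (or p q) → or (from pos p) q }) ,
    mk⇔ (λ { (or p q) → or (to neg′ p) q }) (λ { (or p q) → or (from neg′ p) q })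
  Step-polarity (or₂ s) X = let (pos , neg′) = Step-polarity s X in
    mk⇔ (λ { (or p q) → or p (to pos q) }) (λ { (or p q) → or p (from pos q) }) ,
    mk⇔ (λ { (or p q) → or p (to neg′ q) }) (λ { (or p q) → or p (from neg′ q) })
  Step-polarity (ex s) X = let (pos , neg′) = Step-polarity s X in
    mk⇔ (λ { (ex p) → ex (to pos p) }) (λ { (ex p) → ex (from pos p) }) ,
    mk⇔ (λ { (ex n) → ex (to neg′ n) }) (λ { (ex n) → ex (from neg′ n) })
  Step-polarity (neg s) X = let (pos , neg′) = Step-polarity s X in
    mk⇔ (λ { (neg n) → neg (to neg′ n) }) (λ { (neg n) → neg (from neg′ n) }) ,
    mk⇔ (λ { (neg p) → neg (to pos p) }) (λ { (neg p) → neg (from pos p) })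
  Step-polarity (lfp s) X = let (pos , neg′) = Step-polarity s X in
    mk⇔ (λ { lfp-bound → lfp-bound ; (lfp Y≢X p) → lfp Y≢X (to pos p) })
        (λ { lfp-bound → lfp-bound ; (lfp Y≢X p) → lfp Y≢X (from pos p) }) ,
    mk⇔ (λ { lfp-bound → lfp-bound ; (lfp Y≢X n) → lfp Y≢X (to neg′ n) })
        (λ { lfp-bound → lfp-bound ; (lfp Y≢X n) → lfp Y≢X (from neg′ n) })

  AtMostOne-⊆ : ∀ {l l′} → l ⊆ l′ → AtMostOne {σ} l′ → AtMostOne {σ} l
  AtMostOne-⊆ l⊆l′ one u∈ v∈ = one (l⊆l′ u∈) (l⊆l′ v∈)

  Step-UNFP : ∀ {φ φ′ : Formula σ} → Step φ φ′ → UNFP φ ⇔ UNFP φ′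
  Step-UNFP (∧-ex _) = mk⇔ (λ { (and p (ex q)) → ex (and p q) }) (λ { (ex (and p q)) → and p (ex q) })
  Step-UNFP (ex-∧ _) = mk⇔ (λ { (and (ex q) p) → ex (and q p) }) (λ { (ex (and q p)) → and (ex q) p })
  Step-UNFP (∨-ex _) = mk⇔ (λ { (or p (ex q)) → ex (or p q) }) (λ { (ex (or p q)) → or p (ex q) })
  Step-UNFP (ex-∨ _) = mk⇔ (λ { (or (ex q) p) → ex (or q p) }) (λ { (ex (or q p)) → or (ex q) p })
  Step-UNFP (α-ex {x} {z} {φ} z∉) =
    mk⇔ (λ { (ex p) → ex (to (UNFP-rn x z φ z∉) p) }) (λ { (ex p) → ex (from (UNFP-rn x z φ z∉) p) })
  Step-UNFP (α-lfp {X} {x} {z} {φ} z∉) =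
    mk⇔ (λ { (lfp pos only p) → lfp (to pol pos) (to free only) (to IH p) })
        (λ { (lfp pos only p) → lfp (from pol pos) (from free only) (from IH p) })
    where
    IH = UNFP-rn x z φ z∉
    pol = PosIn-rn x z X φ
    free = OnlyFree-rn x z x φ z∉ (λ x≢x → ⊥-elim (x≢x refl)) (rnVar-≡ x z)
  Step-UNFP (and₁ s) = let IH = Step-UNFP s in
    mk⇔ (λ { (and p q) → and (to IH p) q }) (λ { (and p q) → and (from IH p) q })
  Step-UNFP (and₂ s) = let IH = Step-UNFP s in
    mk⇔ (λ { (and p q) → and p (to IH q) }) (λ { (and p q) → and p (from IH q) })
  Step-UNFP (or₁ s)  = let IH = Step-UNFP s in
    mk⇔ (λ { (or p q) → or (to IH p) q }) (λ { (or p q) → or (from IH p) q })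
  Step-UNFP (or₂ s)  = let IH = Step-UNFP s in
    mk⇔ (λ { (or p q) → or p (to IH q) }) (λ { (or p q) → or p (from IH q) })
  Step-UNFP (ex s)   = let IH = Step-UNFP s in
    mk⇔ (λ { (ex p) → ex (to IH p) }) (λ { (ex p) → ex (from IH p) })
  Step-UNFP (neg s)  =
    mk⇔ (λ { (neg one p) → neg (AtMostOne-⊆ (from (Step-fv s)) one) (to (Step-UNFP s) p) })
        (λ { (neg one p) → neg (AtMostOne-⊆ (to (Step-fv s)) one) (from (Step-UNFP s) p) })
  Step-UNFP (lfp {X} s) = let pos = proj₁ (Step-polarity s X) in
    mk⇔ (λ { (lfp p only u) → lfp (to pos p) (only ∘ from (Step-fv s)) (to (Step-UNFP s) u) })
        (λ { (lfp p only u) → lfp (from pos p) (only ∘ to (Step-fv s)) (from (Step-UNFP s) u) })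

  module _ (M : Structure σ) where

    private D = Carrier M

    upd₀-same : ∀ (ρ : ℕ → D) x d → upd₀ M ρ x d x ≡ d
    upd₀-same ρ x d = if-≡ᵇ-≡ {u = x} d (ρ x) refl

    upd₀-other : ∀ (ρ : ℕ → D) {x u} d → u ≢ x → upd₀ M ρ x d u ≡ ρ u
    upd₀-other ρ {u = u} d = if-≡ᵇ-≢ d (ρ u)

    upd₀-self : ∀ (ρ : ℕ → D) x u → upd₀ M ρ x (ρ x) u ≡ ρ u
    upd₀-self ρ x u with u ≟ x
    ... | yes refl = upd₀-same ρ x (ρ x)
    ... | no u≢x   = upd₀-other ρ (ρ x) u≢x

    upd₀-cong : ∀ {ρ ρ′ : ℕ → D} x d l → (∀ {u} → u ∈ del {σ} x l → ρ u ≡ ρ′ u) →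
                ∀ {u} → u ∈ l → upd₀ M ρ x d u ≡ upd₀ M ρ′ x d u
    upd₀-cong {ρ} {ρ′} x d l ρ≗ρ′ {u} u∈ with u ≟ x
    ... | yes refl = trans (upd₀-same ρ x d) (sym (upd₀-same ρ′ x d))
    ... | no u≢x   = trans (upd₀-other ρ d u≢x)
                       (trans (ρ≗ρ′ (∈-del⁺ l u∈ u≢x)) (sym (upd₀-other ρ′ d u≢x)))

    Sat-fv-cong : ∀ (φ : Formula σ) {ρ ρ′ : ℕ → D} {V} →
                  (∀ {u} → u ∈ fv φ → ρ u ≡ ρ′ u) → Sat M φ ρ V → Sat M φ ρ′ V
    Sat-fv-cong (atom R xs) {ρ} {ρ′} ρ≗ρ′ (lift r) =
      lift (subst (rel M R) (vmap-cong-∈ ρ ρ′ xs ρ≗ρ′) r)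
    Sat-fv-cong (eq x y) ρ≗ρ′ (lift e) =
      lift (trans (sym (ρ≗ρ′ (here refl))) (trans e (ρ≗ρ′ (there (here refl)))))
    Sat-fv-cong (and φ ψ) ρ≗ρ′ (s , t) =
      Sat-fv-cong φ (ρ≗ρ′ ∘ xs⊆xs++ys _ _) s , Sat-fv-cong ψ (ρ≗ρ′ ∘ xs⊆ys++xs _ (fv φ)) t
    Sat-fv-cong (or φ ψ) ρ≗ρ′ (inj₁ s) = inj₁ (Sat-fv-cong φ (ρ≗ρ′ ∘ xs⊆xs++ys _ _) s)
    Sat-fv-cong (or φ ψ) ρ≗ρ′ (inj₂ t) = inj₂ (Sat-fv-cong ψ (ρ≗ρ′ ∘ xs⊆ys++xs _ (fv φ)) t)
    Sat-fv-cong (ex x φ) ρ≗ρ′ (d , s) = d , Sat-fv-cong φ (upd₀-cong x d (fv φ) ρ≗ρ′) s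
    Sat-fv-cong (neg φ) ρ≗ρ′ s t = s (Sat-fv-cong φ (sym ∘ ρ≗ρ′) t)
    Sat-fv-cong (svar X x) {V = V} ρ≗ρ′ (lift v) = lift (subst (V X) (ρ≗ρ′ (here refl)) v)
    Sat-fv-cong (lfp X x φ y) ρ≗ρ′ s P P-closed =
      subst P (ρ≗ρ′ (xs⊆ys++xs _ (del {σ} x (fv φ)) (here refl)))
        (s P λ d t → P-closed d (Sat-fv-cong φ (upd₀-cong x d (fv φ) (ρ≗ρ′ ∘ xs⊆xs++ys _ _)) t))

    Sat-fv-≡ : ∀ (φ : Formula σ) {ρ ρ′ : ℕ → D} {V} →
               (∀ {u} → u ∈ fv φ → ρ u ≡ ρ′ u) → Sat M φ ρ V ⇔ Sat M φ ρ′ V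
    Sat-fv-≡ φ ρ≗ρ′ = mk⇔ (Sat-fv-cong φ ρ≗ρ′) (Sat-fv-cong φ (sym ∘ ρ≗ρ′))

    Sat-ex-cong : ∀ {x x′} {φ φ′ : Formula σ} {ρ ρ′ V} →
                  (∀ d → Sat M φ (upd₀ M ρ x d) V ⇔ Sat M φ′ (upd₀ M ρ′ x′ d) V) →
                  Sat M (ex x φ) ρ V ⇔ Sat M (ex x′ φ′) ρ′ V
    Sat-ex-cong body = mk⇔ (λ (d , s) → d , to (body d) s) (λ (d , s) → d , from (body d) s)

    Sat-lfp-cong : ∀ {X x x′ y y′} {φ φ′ : Formula σ} {ρ ρ′ V} →
                   (∀ d {W} → Sat M φ (upd₀ M ρ x d) W ⇔ Sat M φ′ (upd₀ M ρ′ x′ d) W) →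
                   ρ y ≡ ρ′ y′ →
                   Sat M (lfp X x φ y) ρ V ⇔ Sat M (lfp X x′ φ′ y′) ρ′ V
    Sat-lfp-cong body y≡ =
      mk⇔ (λ s P closed → subst P y≡ (s P λ d t → closed d (to (body d) t)))
          (λ s P closed → subst P (sym y≡) (s P λ d t → closed d (from (body d) t)))

    upd₀-rnVar : ∀ {x z y} (ρ ρ′ : ℕ → D) d l → y ≢ x → z ≢ y →
                 (∀ {u} → u ∈ del {σ} y l → ρ′ (rnVar x z u) ≡ ρ u) →
                 ∀ {u} → u ∈ l → upd₀ M ρ′ y d (rnVar x z u) ≡ upd₀ M ρ y d u
    upd₀-rnVar {x} {z} {y} ρ ρ′ d l y≢x z≢y ρ′∘r≗ρ {u} u∈ with u ≟ y
    ... | yes refl = trans (cong (upd₀ M ρ′ u d) (rnVar-≢ z y≢x))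
                       (trans (upd₀-same ρ′ u d) (sym (upd₀-same ρ u d)))
    ... | no u≢y   = trans (upd₀-other ρ′ d (rnVar-avoids x u z≢y u≢y))
                       (trans (ρ′∘r≗ρ (∈-del⁺ l u∈ u≢y)) (sym (upd₀-other ρ d u≢y)))

    rnVar-del-≗ : ∀ x z l {ρ ρ′ : ℕ → D} →
                  (∀ {u} → u ∈ del {σ} x l → ρ′ (rnVar x z u) ≡ ρ u) →
                  ∀ {u} → u ∈ del {σ} x l → ρ u ≡ ρ′ u
    rnVar-del-≗ x z l {ρ′ = ρ′} ρ′∘r≗ρ u∈ =
      trans (sym (ρ′∘r≗ρ u∈)) (cong ρ′ (rnVar-≢ z (proj₂ (∈-del⁻ l u∈))))

    Sat-rn : ∀ x z (φ : Formula σ) {ρ ρ′ : ℕ → D} {V} → z ∉ vars φ →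
             (∀ {u} → u ∈ fv φ → ρ′ (rnVar x z u) ≡ ρ u) → Sat M φ ρ V ⇔ Sat M (rn x z φ) ρ′ V
    Sat-rn x z (atom R us) {ρ} {ρ′} z∉ ρ′∘r≗ρ =
      mk⇔ (λ (lift r) → lift (subst (rel M R) (sym same) r)) (λ (lift r) → lift (subst (rel M R) same r))
      where
      same : vmap ρ′ (vmap (rnVar x z) us) ≡ vmap ρ us
      same = trans (sym (map-∘ ρ′ (rnVar x z) us)) (vmap-cong-∈ (ρ′ ∘ rnVar x z) ρ us ρ′∘r≗ρ)
    Sat-rn x z (eq a b) z∉ ρ′∘r≗ρ =
      let a≡ = ρ′∘r≗ρ (here refl) ; b≡ = ρ′∘r≗ρ (there (here refl)) in
      mk⇔ (λ (lift e) → lift (trans a≡ (trans e (sym b≡))))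
          (λ (lift e) → lift (trans (sym a≡) (trans e b≡)))
    Sat-rn x z (and φ ψ) z∉ ρ′∘r≗ρ =
      Sat-rn x z φ (z∉ ∘ xs⊆xs++ys _ _) (ρ′∘r≗ρ ∘ xs⊆xs++ys _ _) ×-⇔
      Sat-rn x z ψ (z∉ ∘ xs⊆ys++xs _ (vars φ)) (ρ′∘r≗ρ ∘ xs⊆ys++xs _ (fv φ))
    Sat-rn x z (or φ ψ) z∉ ρ′∘r≗ρ =
      Sat-rn x z φ (z∉ ∘ xs⊆xs++ys _ _) (ρ′∘r≗ρ ∘ xs⊆xs++ys _ _) ⊎-⇔
      Sat-rn x z ψ (z∉ ∘ xs⊆ys++xs _ (vars φ)) (ρ′∘r≗ρ ∘ xs⊆ys++xs _ (fv φ))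
    Sat-rn x z (neg φ) z∉ ρ′∘r≗ρ = ¬-cong-⇔ (Sat-rn x z φ z∉ ρ′∘r≗ρ)
    Sat-rn x z (svar X a) {V = V} z∉ ρ′∘r≗ρ =
      mk⇔ (λ (lift v) → lift (subst (V X) (sym (ρ′∘r≗ρ (here refl))) v))
          (λ (lift v) → lift (subst (V X) (ρ′∘r≗ρ (here refl)) v))
    Sat-rn x z (ex y φ) {ρ} {ρ′} z∉ ρ′∘r≗ρ with y ≟ x
    ... | yes refl rewrite rn-ex-bound y z φ =
      Sat-ex-cong λ d → Sat-fv-≡ φ (upd₀-cong y d (fv φ) (rnVar-del-≗ y z (fv φ) ρ′∘r≗ρ))
    ... | no y≢x rewrite rn-ex-free z φ y≢x =
      Sat-ex-cong λ d → Sat-rn x z φ (z∉ ∘ there)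
        (upd₀-rnVar ρ ρ′ d (fv φ) y≢x (∉∧∈⇒≢ z∉ (here refl)) ρ′∘r≗ρ)
    Sat-rn x z (lfp X y φ w) {ρ} {ρ′} z∉ ρ′∘r≗ρ with y ≟ x
    ... | yes refl rewrite if-≡ᵇ-≡ {u = y} φ (rn y z φ) refl =
      Sat-lfp-cong
        (λ d → Sat-fv-≡ φ (upd₀-cong y d (fv φ) (rnVar-del-≗ y z (fv φ) (ρ′∘r≗ρ ∘ xs⊆xs++ys _ _))))
        (sym (ρ′∘r≗ρ (xs⊆ys++xs _ (del {σ} y (fv φ)) (here refl))))
    ... | no y≢x rewrite if-≡ᵇ-≢ φ (rn x z φ) y≢x =
      Sat-lfp-cong
        (λ d → Sat-rn x z φ (z∉ ∘ there ∘ there)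
                 (upd₀-rnVar ρ ρ′ d (fv φ) y≢x (∉∧∈⇒≢ z∉ (here refl)) (ρ′∘r≗ρ ∘ xs⊆xs++ys _ _)))
        (sym (ρ′∘r≗ρ (xs⊆ys++xs _ (del {σ} y (fv φ)) (here refl))))

    upd₀-rnVar-binder : ∀ {x z} (φ : Formula σ) (ρ : ℕ → D) d → z ∉ vars φ →
                        ∀ {u} → u ∈ fv φ → upd₀ M ρ z d (rnVar x z u) ≡ upd₀ M ρ x d u
    upd₀-rnVar-binder {x} {z} φ ρ d z∉ {u} u∈ with u ≟ x
    ... | yes refl = trans (cong (upd₀ M ρ z d) (rnVar-≡ u z))
                       (trans (upd₀-same ρ z d) (sym (upd₀-same ρ u d)))
    ... | no u≢x   = trans (cong (upd₀ M ρ z d) (rnVar-≢ z u≢x))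
                       (trans (upd₀-other ρ d (≢-sym (∉∧∈⇒≢ z∉ (fv⊆vars φ u∈))))
                         (sym (upd₀-other ρ d u≢x)))

    Sat-upd-fresh : ∀ {x} (φ : Formula σ) {ρ : ℕ → D} {V} d → x ∉ fv φ →
                    Sat M φ ρ V ⇔ Sat M φ (upd₀ M ρ x d) V
    Sat-upd-fresh φ {ρ} d x∉ = Sat-fv-≡ φ λ u∈ →
      sym (upd₀-other ρ d (≢-sym (∉∧∈⇒≢ x∉ u∈)))


    Step-Sat : ∀ {φ φ′ : Formula σ} → Step φ φ′ →
               ∀ {ρ : ℕ → D} {V} → Sat M φ ρ V ⇔ Sat M φ′ ρ V
    Step-Sat (∧-ex {φ = φ} x∉) =
      mk⇔ (λ (s , (d , t)) → d , to (Sat-upd-fresh φ d x∉) s , t)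
          (λ (d , s , t) → from (Sat-upd-fresh φ d x∉) s , (d , t))
    Step-Sat (ex-∧ {φ = φ} x∉) =
      mk⇔ (λ ((d , t) , s) → d , t , to (Sat-upd-fresh φ d x∉) s)
          (λ (d , t , s) → (d , t) , from (Sat-upd-fresh φ d x∉) s)
    Step-Sat (∨-ex {x} {φ} x∉) {ρ} =
      mk⇔ (λ { (inj₁ s) → ρ x , inj₁ (to (Sat-upd-fresh φ (ρ x) x∉) s)
             ; (inj₂ (d , t)) → d , inj₂ t })
          (λ { (d , inj₁ s) → inj₁ (from (Sat-upd-fresh φ d x∉) s) ; (d , inj₂ t) → inj₂ (d , t) })
    Step-Sat (ex-∨ {x} {φ} x∉) {ρ} =
      mk⇔ (λ { (inj₂ s) → ρ x , inj₂ (to (Sat-upd-fresh φ (ρ x) x∉) s)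
             ; (inj₁ (d , t)) → d , inj₁ t })
          (λ { (d , inj₂ s) → inj₂ (from (Sat-upd-fresh φ d x∉) s) ; (d , inj₁ t) → inj₁ (d , t) })
    Step-Sat (α-ex {x} {z} {φ} z∉) {ρ} =
      Sat-ex-cong λ d → Sat-rn x z φ z∉ (upd₀-rnVar-binder φ ρ d z∉)
    Step-Sat (α-lfp {x = x} {z} {φ} z∉) {ρ} =
      Sat-lfp-cong (λ d → Sat-rn x z φ z∉ (upd₀-rnVar-binder φ ρ d z∉)) refl
    Step-Sat (and₁ s) = Step-Sat s ×-⇔ ⇔-id _
    Step-Sat (and₂ s) = ⇔-id _ ×-⇔ Step-Sat s
    Step-Sat (or₁ s)  = Step-Sat s ⊎-⇔ ⇔-id _
    Step-Sat (or₂ s)  = ⇔-id _ ⊎-⇔ Step-Sat s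
    Step-Sat (ex s)   = Sat-ex-cong λ d → Step-Sat s
    Step-Sat (neg s)  = ¬-cong-⇔ (Step-Sat s)
    Step-Sat (lfp s)  = Sat-lfp-cong (λ d → Step-Sat s) refl

  Rewrites-⇔ : ∀ {ℓ} (P : Formula σ → Set ℓ) → (∀ {φ φ′} → Step φ φ′ → P φ ⇔ P φ′) →
               ∀ {φ ψ} → Rewrites φ ψ → P φ ⇔ P ψ
  Rewrites-⇔ P step ε              = ⇔-id _
  Rewrites-⇔ P step (fwd s ◅ rest) = Rewrites-⇔ P step rest ⇔-∘ step s
  Rewrites-⇔ P step (bwd s ◅ rest) = Rewrites-⇔ P step rest ⇔-∘ ⇔-sym (step s)

  record Bisim (B : ℕ → Set) (M N : Structure σ) : Set₁ where
    field
      Z     : Carrier M → Carrier N → Set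
      forth : Forth B M N Z
      back  : Forth B N M (λ b a → Z a b)
      a₀    : Carrier M
      b₀    : Carrier N
      z₀    : Z a₀ b₀

  open Bisim

  converse : ∀ {B M N} → Bisim B M N → Bisim B N M
  converse c = record
    { Z = λ b a → Z c a b ; forth = back c ; back = forth c ; a₀ = b₀ c ; b₀ = a₀ c ; z₀ = z₀ c }

  Transports : {A A′ : Set} → (A → A′ → Set) → (A → Set) → (A′ → Set) → Set
  Transports Z S S′ = ∀ a b → Z a b → S a → S′ b

  -- A fixpoint variable need only be transported forwards where it occurs positively.
  Compatible : {A A′ : Set} → (A → A′ → Set) → (ℕ → A → Set) → (ℕ → A′ → Set) →
               Formula σ → Set
  Compatible Z V V′ φ = ∀ Y → (Transports Z (V Y) (V′ Y) × Transports (λ b a → Z a b) (V′ Y) (V Y))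
                            ⊎ (Transports Z (V Y) (V′ Y) × PosIn Y φ)
                            ⊎ (Transports (λ b a → Z a b) (V′ Y) (V Y) × NegIn Y φ)

  Compatible-∅ : ∀ {A A′ : Set} {Z : A → A′ → Set} {φ} →
                 Compatible Z (λ _ _ → ⊥) (λ _ _ → ⊥) φ
  Compatible-∅ Y = inj₁ ((λ _ _ _ ()) , (λ _ _ _ ()))

  module _ {A A′ : Set} {Z : A → A′ → Set} {V : ℕ → A → Set} {V′ : ℕ → A′ → Set} where

    Compatible-sub : ∀ {φ ψ} →
                     (∀ {Y} → PosIn Y φ → PosIn Y ψ) → (∀ {Y} → NegIn Y φ → NegIn Y ψ) →
                     Compatible Z V V′ φ → Compatible Z V V′ ψ
    Compatible-sub pos neg′ compat Y with compat Y
    ... | inj₁ both              = inj₁ both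
    ... | inj₂ (inj₁ (fw , p))   = inj₂ (inj₁ (fw , pos p))
    ... | inj₂ (inj₂ (bw , n))   = inj₂ (inj₂ (bw , neg′ n))

    Compatible-and : ∀ {φ ψ} → Compatible Z V V′ (and φ ψ) →
                     Compatible Z V V′ φ × Compatible Z V V′ ψ
    Compatible-and compat = Compatible-sub (λ { (and p _) → p }) (λ { (and n _) → n }) compat
                          , Compatible-sub (λ { (and _ p) → p }) (λ { (and _ n) → n }) compat

    Compatible-or : ∀ {φ ψ} → Compatible Z V V′ (or φ ψ) →
                    Compatible Z V V′ φ × Compatible Z V V′ ψ
    Compatible-or compat = Compatible-sub (λ { (or p _) → p }) (λ { (or n _) → n }) compat
                         , Compatible-sub (λ { (or _ p) → p }) (λ { (or _ n) → n }) compat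

    Compatible-ex : ∀ {x φ} → Compatible Z V V′ (ex x φ) → Compatible Z V V′ φ
    Compatible-ex = Compatible-sub (λ { (ex p) → p }) (λ { (ex n) → n })

    Compatible-neg : ∀ {φ} → Compatible Z V V′ (neg φ) → Compatible (λ b a → Z a b) V′ V φ
    Compatible-neg compat Y with compat Y
    ... | inj₁ (fw , bw)             = inj₁ (bw , fw)
    ... | inj₂ (inj₁ (fw , neg n))   = inj₂ (inj₂ (fw , n))
    ... | inj₂ (inj₂ (bw , neg p))   = inj₂ (inj₁ (bw , p))

    Compatible-svar : ∀ {X x} → Compatible Z V V′ (svar X x) → Transports Z (V X) (V′ X)
    Compatible-svar {X} compat with compat X
    ... | inj₁ (fw , _)              = fw
    ... | inj₂ (inj₁ (fw , _))       = fw
    ... | inj₂ (inj₂ (_ , svar X≢X)) = ⊥-elim (X≢X refl)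

    Compatible-lfp : ∀ {X x φ y} (P : A → Set) (Q : A′ → Set) → Transports Z P Q → PosIn X φ →
                     Compatible Z V V′ (lfp X x φ y) →
                     Compatible Z (λ Y → if Y ≡ᵇ X then P else V Y)
                                  (λ Y → if Y ≡ᵇ X then Q else V′ Y) φ
    Compatible-lfp {X} P Q P⇒Q pos compat Y with Y ≟ X
    ... | yes refl rewrite if-≡ᵇ-≡ {u = Y} P (V Y) refl | if-≡ᵇ-≡ {u = Y} Q (V′ Y) refl =
      inj₂ (inj₁ (P⇒Q , pos))
    ... | no Y≢X rewrite if-≡ᵇ-≢ P (V Y) Y≢X | if-≡ᵇ-≢ Q (V′ Y) Y≢X with compat Y
    ...   | inj₁ both                    = inj₁ both
    ...   | inj₂ (inj₁ (_ , lfp-bound))  = ⊥-elim (Y≢X refl)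
    ...   | inj₂ (inj₁ (fw , lfp _ p))   = inj₂ (inj₁ (fw , p))
    ...   | inj₂ (inj₂ (_ , lfp-bound))  = ⊥-elim (Y≢X refl)
    ...   | inj₂ (inj₂ (bw , lfp _ n))   = inj₂ (inj₂ (bw , n))

  Covers : {A A′ : Set} {m : ℕ} → (Fin m → A) → (Fin m → A′) → (ℕ → A) → (ℕ → A′) →
           List ℕ → Set
  Covers xs ys ρ ρ′ l = ∀ {u} → u ∈ l → ∃ λ i → xs i ≡ ρ u × ys i ≡ ρ′ u

  module _ (M N : Structure σ) {m} {xs : Fin m → Carrier M} {ys : Fin m → Carrier N}
           (hom : PartialHom M N xs ys) where

    covered-tuple : ∀ {n} {ρ ρ′} (us : Vec ℕ n) → Covers xs ys ρ ρ′ (toList us) →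
                    ∃ λ is → vmap xs is ≡ vmap ρ us × vmap ys is ≡ vmap ρ′ us
    covered-tuple v[]        cov = v[] , refl , refl
    covered-tuple (u v∷ us) cov with cov (here refl) | covered-tuple us (cov ∘ there)
    ... | i , xi≡ , yi≡ | is , xs≡ , ys≡ = i v∷ is , cong₂ _v∷_ xi≡ xs≡ , cong₂ _v∷_ yi≡ ys≡

    hom-rel : ∀ {R ρ ρ′} (us : Vec ℕ (arity σ R)) → Covers xs ys ρ ρ′ (toList us) →
              rel M R (vmap ρ us) → rel N R (vmap ρ′ us)
    hom-rel {R} us cov r with covered-tuple us cov
    ... | is , xs≡ , ys≡ = subst (rel N R) ys≡ (proj₂ hom R is (subst (rel M R) (sym xs≡) r))

    hom-≡ : ∀ {a b ρ ρ′} → Covers xs ys ρ ρ′ (a ∷ b ∷ []) → ρ a ≡ ρ b → ρ′ a ≡ ρ′ b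
    hom-≡ cov e with cov (here refl) | cov (there (here refl))
    ... | i , xi≡ , yi≡ | j , xj≡ , yj≡ =
      trans (sym yi≡) (trans (proj₁ hom i j (trans xi≡ (trans e (sym xj≡)))) yj≡)

  PointTransfer : ∀ {B M N} → Bisim B M N → Formula σ → Set₁
  PointTransfer {M = M} {N} c φ =
    ∀ {V V′} → Compatible (Z c) V V′ φ → ∀ {ρ ρ′ a b} → Z c a b →
    (∀ {u} → u ∈ fv φ → ρ u ≡ a × ρ′ u ≡ b) → Sat M φ ρ V → Sat N φ ρ′ V′

  record ZHom {B M N} (c : Bisim B M N) (m : ℕ) : Set where
    field
      dom   : Fin m → Carrier M
      img   : Fin m → Carrier N
      isHom : PartialHom M N dom img
      inZ   : ∀ i → Z c (dom i) (img i)

  open ZHom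

  module _ {B} {M N : Structure σ} (c : Bisim B M N) where

    ZRelated : (ℕ → Carrier M) → (ℕ → Carrier N) → List ℕ → Set
    ZRelated ρ ρ′ l = ∀ {u} → u ∈ l → Z c (ρ u) (ρ′ u)

    Covers⇒ZRelated : ∀ {m} (h : ZHom c m) {ρ ρ′ l} →
                      Covers (dom h) (img h) ρ ρ′ l → ZRelated ρ ρ′ l
    Covers⇒ZRelated h cov u∈ = let (i , dom≡ , img≡) = cov u∈ in subst₂ (Z c) dom≡ img≡ (inZ h i)

    -- An empty list needs some pair of Z: this is where non-emptiness of the bisimulation is used.
    common-pair : ∀ {ρ ρ′} l → AtMostOne {σ} l → ZRelated ρ ρ′ l →
                  ∃₂ λ a b → Z c a b × (∀ {u} → u ∈ l → ρ u ≡ a × ρ′ u ≡ b)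
    common-pair []      one rel = a₀ c , b₀ c , z₀ c , λ ()
    common-pair {ρ} {ρ′} (v ∷ l) one rel =
      ρ v , ρ′ v , rel (here refl) , λ u∈ → cong ρ (one u∈ (here refl)) , cong ρ′ (one u∈ (here refl))

    Sat-svar-transfer : ∀ {X x ρ ρ′ V V′} → Compatible (Z c) V V′ (svar X x) → Z c (ρ x) (ρ′ x) →
                        Sat M (svar X x) ρ V → Sat N (svar X x) ρ′ V′
    Sat-svar-transfer compat z (lift v) = lift (Compatible-svar compat _ _ z v)

    Sat-neg-transfer : ∀ {φ ρ ρ′ V V′} → PointTransfer (converse c) φ → AtMostOne {σ} (fv φ) →
                       Compatible (Z c) V V′ (neg φ) → ZRelated ρ ρ′ (fv φ) →
                       Sat M (neg φ) ρ V → Sat N (neg φ) ρ′ V′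
    Sat-neg-transfer {φ} back-transfer one compat rel ¬s t with common-pair (fv φ) one rel
    ... | a , b , z , at =
      ¬s (back-transfer (Compatible-neg compat) z (λ u∈ → proj₂ (at u∈) , proj₁ (at u∈)) t)

    -- The least fixpoint in M lies inside the prefixed point "all Z-partners satisfy Q".
    Sat-lfp-transfer : ∀ {X x φ y ρ ρ′ V V′} → PosIn X φ → OnlyFree x φ → PointTransfer c φ →
                       Compatible (Z c) V V′ (lfp X x φ y) → Z c (ρ y) (ρ′ y) →
                       Sat M (lfp X x φ y) ρ V → Sat N (lfp X x φ y) ρ′ V′
    Sat-lfp-transfer {X} {x} {φ} {y} {ρ} {ρ′} {V} pos only body compat z s Q Q-closed =
      s P P-closed (ρ′ y) z
      where
      P : Carrier M → Set
      P a = ∀ b → Z c a b → Q b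
      P-closed : ∀ d → Sat M φ (upd₀ M ρ x d) (upd M V X P) → P d
      P-closed d t b z′ =
        Q-closed b (body (Compatible-lfp P Q (λ a b z Pa → Pa b z) pos compat) z′ at-x t)
        where
        at-x : ∀ {u} → u ∈ fv φ → upd₀ M ρ x d u ≡ d × upd₀ N ρ′ x b u ≡ b
        at-x u∈ with only u∈
        ... | refl = upd₀-same M ρ x d , upd₀-same N ρ′ x b

  SatAlong : ∀ {B M N} → Bisim B M N → Formula σ → (ℕ → Carrier N → Set) →
             (ℕ → Carrier M) → Carrier M → Carrier N → Set₁
  SatAlong {N = N} c φ V′ ρ a b =
    ∃ λ ρ′ → (∀ {u} → u ∈ fv φ → ρ u ≡ a → ρ′ u ≡ b) × Sat N φ ρ′ V′

  module WidthBounded {B : ℕ → Set} (vs : List ℕ) (B-vs : B (length vs)) where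

    mutual
      transfer-nf : ∀ {M N} (c : Bisim B M N) (φ : Formula σ) {ok} → NFat ok φ → UNFP φ → vars φ ⊆ vs →
                    ∀ {V V′} → Compatible (Z c) V V′ φ →
                    ∀ {ρ a b} → Z c a b → Sat M φ ρ V → SatAlong c φ V′ ρ a b
      transfer-nf {M} {N} c (ex x φ) (_ , nf) (ex u) ⊆vs compat {ρ} z (d , s)
        with transfer-nf c φ nf u (⊆vs ∘ there) (Compatible-ex compat) z s
      ... | ρ′ , along , t =
        ρ′ , along-ex , ρ′ x , Sat-fv-cong N φ (λ {u} _ → sym (upd₀-self N ρ′ x u)) t
        where
        along-ex : ∀ {u} → u ∈ fv (ex x φ) → ρ u ≡ _ → ρ′ u ≡ _
        along-ex u∈ ρu≡a = let (u∈φ , u≢x) = ∈-del⁻ (fv φ) u∈ in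
                           along u∈φ (trans (upd₀-other M ρ d u≢x) ρu≡a)
      transfer-nf c θ@(atom _ _)     nf u ⊆vs compat z s = transfer-block c θ nf u ⊆vs compat z s
      transfer-nf c θ@(eq _ _)       nf u ⊆vs compat z s = transfer-block c θ nf u ⊆vs compat z s
      transfer-nf c θ@(and _ _)      nf u ⊆vs compat z s = transfer-block c θ nf u ⊆vs compat z s
      transfer-nf c θ@(or _ _)       nf u ⊆vs compat z s = transfer-block c θ nf u ⊆vs compat z s
      transfer-nf c θ@(neg _)        nf u ⊆vs compat z s = transfer-block c θ nf u ⊆vs compat z s
      transfer-nf c θ@(svar _ _)     nf u ⊆vs compat z s = transfer-block c θ nf u ⊆vs compat z s
      transfer-nf c θ@(lfp _ _ _ _)  nf u ⊆vs compat z s = transfer-block c θ nf u ⊆vs compat z s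

      -- A single application of forth to the values of all of vs, sending a to b.
      transfer-block : ∀ {M N} (c : Bisim B M N) (θ : Formula σ) → NFat false θ → UNFP θ →
                       vars θ ⊆ vs → ∀ {V V′} → Compatible (Z c) V V′ θ →
                       ∀ {ρ a b} → Z c a b → Sat M θ ρ V → SatAlong c θ V′ ρ a b
      transfer-block {M} {N} c θ nf u ⊆vs compat {ρ} {a} {b} z s
        with forth c a b z (length vs) B-vs (ρ ∘ lookup vs)
      ... | ys , hom , a↦b , inZ′ = ρ′ , along , transfer-hom c θ nf u ⊆vs compat h cov s
        where
        h : ZHom c (length vs)
        h = record { dom = ρ ∘ lookup vs ; img = ys ; isHom = hom ; inZ = inZ′ }
        ρ′ : ℕ → Carrier N
        ρ′ v with v ∈? vs
        ... | yes v∈ = ys (index v∈)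
        ... | no _   = b
        cov : Covers (ρ ∘ lookup vs) ys ρ ρ′ (fv θ)
        cov {v} v∈ with v ∈? vs
        ... | yes v∈vs = index v∈vs , cong ρ (sym (lookup-index v∈vs)) , refl
        ... | no v∉vs  = ⊥-elim (v∉vs (⊆vs (fv⊆vars θ v∈)))
        along : ∀ {v} → v ∈ fv θ → ρ v ≡ a → ρ′ v ≡ b
        along {v} _ ρv≡a with v ∈? vs
        ... | yes v∈vs = a↦b (index v∈vs) (trans (cong ρ (sym (lookup-index v∈vs))) ρv≡a)
        ... | no _     = refl

      transfer-hom : ∀ {M N} (c : Bisim B M N) (θ : Formula σ) → NFat false θ → UNFP θ → vars θ ⊆ vs →
                     ∀ {V V′} → Compatible (Z c) V V′ θ → ∀ {m} (h : ZHom c m) {ρ ρ′} →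
                     Covers (dom h) (img h) ρ ρ′ (fv θ) → Sat M θ ρ V → Sat N θ ρ′ V′
      transfer-hom {M} {N} c (atom R us) nf u ⊆vs compat h cov (lift r) = lift (hom-rel M N (isHom h) us cov r)
      transfer-hom {M} {N} c (eq a b)    nf u ⊆vs compat h cov (lift e) = lift (hom-≡ M N (isHom h) cov e)
      transfer-hom c (and φ ψ) (nfφ , nfψ) (and uφ uψ) ⊆vs compat h cov (s , t) =
        transfer-hom c φ nfφ uφ (⊆vs ∘ xs⊆xs++ys _ _) (proj₁ (Compatible-and compat))
          h (cov ∘ xs⊆xs++ys _ _) s ,
        transfer-hom c ψ nfψ uψ (⊆vs ∘ xs⊆ys++xs _ (vars φ)) (proj₂ (Compatible-and compat))
          h (cov ∘ xs⊆ys++xs _ (fv φ)) t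
      transfer-hom c (or φ ψ) (nfφ , nfψ) (or uφ uψ) ⊆vs compat h cov (inj₁ s) =
        inj₁ (transfer-hom c φ nfφ uφ (⊆vs ∘ xs⊆xs++ys _ _) (proj₁ (Compatible-or compat))
                h (cov ∘ xs⊆xs++ys _ _) s)
      transfer-hom c (or φ ψ) (nfφ , nfψ) (or uφ uψ) ⊆vs compat h cov (inj₂ t) =
        inj₂ (transfer-hom c ψ nfψ uψ (⊆vs ∘ xs⊆ys++xs _ (vars φ)) (proj₂ (Compatible-or compat))
                h (cov ∘ xs⊆ys++xs _ (fv φ)) t)
      transfer-hom c (ex x φ) (inj₁ () , _) u ⊆vs compat h cov s
      -- A non-root ∃ has at most one free variable, so it restarts from a single pair of Z.
      transfer-hom {M} {N} c (ex x φ) (inj₂ one , nf) (ex u) ⊆vs compat h {ρ} {ρ′} cov (d , s)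
        with common-pair c (fv (ex x φ)) one (Covers⇒ZRelated c h cov)
      ... | a , b , z , at
        with transfer-nf c φ nf u (⊆vs ∘ there) (Compatible-ex compat) z s
      ... | ρ″ , along , t = ρ″ x , Sat-fv-cong N φ ρ″≗ t
        where
        ρ″≗ : ∀ {v} → v ∈ fv φ → ρ″ v ≡ upd₀ N ρ′ x (ρ″ x) v
        ρ″≗ {v} v∈ with v ≟ x
        ... | yes refl = sym (upd₀-same N ρ′ v (ρ″ v))
        ... | no v≢x   = let v∈ex = ∈-del⁺ (fv φ) v∈ v≢x in
          trans (along v∈ (trans (upd₀-other M ρ d v≢x) (proj₁ (at v∈ex))))
                (trans (sym (proj₂ (at v∈ex))) (sym (upd₀-other N ρ′ (ρ″ x) v≢x)))
      transfer-hom c (neg φ) nf (neg one u) ⊆vs compat h cov s =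
        Sat-neg-transfer c (point-transfer (converse c) φ nf u ⊆vs) one compat (Covers⇒ZRelated c h cov) s
      transfer-hom c (svar X x) nf u ⊆vs compat h {ρ} {ρ′} cov s =
        Sat-svar-transfer c {ρ = ρ} {ρ′} compat (Covers⇒ZRelated c h cov (here refl)) s
      transfer-hom c (lfp X x φ y) nf (lfp pos only u) ⊆vs compat h cov s =
        Sat-lfp-transfer c pos only (point-transfer c φ nf u (⊆vs ∘ there ∘ there)) compat
          (Covers⇒ZRelated c h cov (xs⊆ys++xs _ (del {σ} x (fv φ)) (here refl))) s

      point-transfer : ∀ {M N} (c : Bisim B M N) (φ : Formula σ) {ok} → NFat ok φ → UNFP φ →
                       vars φ ⊆ vs → PointTransfer c φ
      point-transfer {N = N} c φ nf u ⊆vs compat z at s with transfer-nf c φ nf u ⊆vs compat z s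
      ... | ρ″ , along , t =
        Sat-fv-cong N φ (λ v∈ → trans (along v∈ (proj₁ (at v∈))) (sym (proj₂ (at v∈)))) t

  Covers-upd₀ : ∀ (M N : Structure σ) {m} {xs : Fin m → Carrier M} {ys : Fin m → Carrier N}
                {ρ ρ′ x d i} l →
                xs i ≡ d → Covers xs ys ρ ρ′ (del {σ} x l) →
                Covers xs ys (upd₀ M ρ x d) (upd₀ N ρ′ x (ys i)) l
  Covers-upd₀ M N {ys = ys} {ρ} {ρ′} {x} {d} {i} l xi≡d cov {u} u∈ with u ≟ x
  ... | yes refl = i , trans xi≡d (sym (upd₀-same M ρ u d)) , sym (upd₀-same N ρ′ u (ys i))
  ... | no u≢x with cov (∈-del⁺ l u∈ u≢x)
  ...   | j , xj≡ , yj≡ =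
    j , trans xj≡ (sym (upd₀-other M ρ d u≢x)) , trans yj≡ (sym (upd₀-other N ρ′ (ys i) u≢x))

  module Unbounded {B : ℕ → Set} (B-all : ∀ m → B m) where

    Witnessed : ∀ {M N} → Bisim B M N → Formula σ → (ℕ → Carrier N → Set) →
                (ℕ → Carrier M) → Set₁
    Witnessed {M} {N} c θ V′ ρ =
      ∃ λ (ws : List (Carrier M)) → ∀ {m} (h : ZHom c m) → (∀ {w} → w ∈ ws → ∃ λ i → dom h i ≡ w) →
      ∀ {ρ′} → Covers (dom h) (img h) ρ ρ′ (fv θ) → Sat N θ ρ′ V′

    mutual
      witnesses : ∀ {M N} (c : Bisim B M N) (θ : Formula σ) → UNFP θ →
                  ∀ {V V′} → Compatible (Z c) V V′ θ → ∀ {ρ} → Sat M θ ρ V → Witnessed c θ V′ ρ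
      witnesses {M} {N} c (atom R us) _ compat (lift r) = [] , λ h _ cov → lift (hom-rel M N (isHom h) us cov r)
      witnesses {M} {N} c (eq a b)    _ compat (lift e) = [] , λ h _ cov → lift (hom-≡ M N (isHom h) cov e)
      witnesses c (and φ ψ) (and uφ uψ) compat (s , t)
        with witnesses c φ uφ (proj₁ (Compatible-and compat)) s
           | witnesses c ψ uψ (proj₂ (Compatible-and compat)) t
      ... | ws₁ , K₁ | ws₂ , K₂ =
        ws₁ ++ ws₂ , λ h embeds cov → K₁ h (embeds ∘ xs⊆xs++ys _ _) (cov ∘ xs⊆xs++ys _ _) ,
                                       K₂ h (embeds ∘ xs⊆ys++xs _ ws₁) (cov ∘ xs⊆ys++xs _ (fv φ))
      witnesses c (or φ ψ) (or uφ uψ) compat (inj₁ s)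
        with witnesses c φ uφ (proj₁ (Compatible-or compat)) s
      ... | ws , K = ws , λ h embeds cov → inj₁ (K h embeds (cov ∘ xs⊆xs++ys _ _))
      witnesses c (or φ ψ) (or uφ uψ) compat (inj₂ t)
        with witnesses c ψ uψ (proj₂ (Compatible-or compat)) t
      ... | ws , K = ws , λ h embeds cov → inj₂ (K h embeds (cov ∘ xs⊆ys++xs _ (fv φ)))
      witnesses {M} {N} c (ex x φ) (ex u) compat (d , s)
        with witnesses c φ u (Compatible-ex compat) s
      ... | ws , K = d ∷ ws , λ h embeds cov →
        let (i , i↦d) = embeds (here refl) in
        img h i , K h (embeds ∘ there) (Covers-upd₀ M N (fv φ) i↦d cov)
      witnesses c (neg φ) (neg one u) compat s =
        [] , λ h _ cov →
          Sat-neg-transfer c (point-transfer (converse c) φ u) one compat (Covers⇒ZRelated c h cov) s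
      witnesses c (svar X x) _ compat {ρ} s =
        [] , λ h _ {ρ′} cov →
          Sat-svar-transfer c {ρ = ρ} {ρ′} compat (Covers⇒ZRelated c h cov (here refl)) s
      witnesses c (lfp X x φ y) (lfp pos only u) compat s =
        [] , λ h _ cov → Sat-lfp-transfer c pos only (point-transfer c φ u) compat
                           (Covers⇒ZRelated c h cov (xs⊆ys++xs _ (del {σ} x (fv φ)) (here refl))) s

      -- A single application of forth to a and all witnesses, sending a to b.
      point-transfer : ∀ {M N} (c : Bisim B M N) (φ : Formula σ) → UNFP φ → PointTransfer c φ
      point-transfer {M} {N} c φ u compat {ρ} {ρ′} {a} {b} z at s with witnesses c φ u compat s
      ... | ws , K with forth c a b z (length (a ∷ ws)) (B-all _) (lookup (a ∷ ws))
      ... | ys , hom , a↦b , inZ′ = K h embeds cov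
        where
        h : ZHom c (length (a ∷ ws))
        h = record { dom = lookup (a ∷ ws) ; img = ys ; isHom = hom ; inZ = inZ′ }
        embeds : ∀ {w} → w ∈ ws → ∃ λ i → lookup (a ∷ ws) i ≡ w
        embeds w∈ = Fin.suc (index w∈) , sym (lookup-index w∈)
        cov : Covers (lookup (a ∷ ws)) ys ρ ρ′ (fv φ)
        cov u∈ = Fin.zero , sym (proj₁ (at u∈)) , trans (a↦b Fin.zero refl) (sym (proj₂ (at u∈)))

  toBisim : ∀ {B M N} →
            Σ[ Z ∈ (Carrier M → Carrier N → Set) ] IsBisim B M N Z × (∃[ a ] ∃[ b ] Z a b) →
            Bisim B M N
  toBisim (Z , (fw , bw) , a , b , z) =
    record { Z = Z ; forth = fw ; back = bw ; a₀ = a ; b₀ = b ; z₀ = z }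

  sentence-transfer : ∀ {B M N} (c : Bisim B M N) {φ : Formula σ} →
                      fv φ ≡ [] → PointTransfer c φ → M ⊨ φ → N ⊨ φ
  sentence-transfer c closed transfer M⊨φ ρ′ =
    transfer Compatible-∅ (z₀ c) (λ u∈ → case subst (_ ∈_) closed u∈ of λ ()) (M⊨φ (λ _ → a₀ c))

  Agree-transfer : ∀ {B} {M N : Structure σ} {φ : Formula σ} → Bisim B M N → fv φ ≡ [] →
                   (∀ {M′ N′} (c : Bisim B M′ N′) → PointTransfer c φ) → Agree M N φ
  Agree-transfer c closed transfer =
    sentence-transfer c closed (transfer c) , sentence-transfer (converse c) closed (transfer (converse c))

  Rewrites-fv : ∀ {φ ψ : Formula σ} → Rewrites φ ψ → fv φ ∼[ set ] fv ψ
  Rewrites-fv φ↝ψ {u} = Rewrites-⇔ (λ θ → u ∈ fv θ) (λ s → Step-fv s) φ↝ψ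

  Rewrites-closed : ∀ {φ ψ : Formula σ} → Rewrites φ ψ → fv φ ≡ [] → fv ψ ≡ []
  Rewrites-closed φ↝ψ closed = ⊆[]⇒≡[] (subst (_ ∈_) closed ∘ from (Rewrites-fv φ↝ψ))

  ⊨-rewrites : ∀ (K : Structure σ) {φ ψ} → Rewrites φ ψ → (K ⊨ φ) ⇔ (K ⊨ ψ)
  ⊨-rewrites K φ↝ψ =
    mk⇔ (λ K⊨φ ρ → to (Sat⇔ ρ) (K⊨φ ρ)) (λ K⊨ψ ρ → from (Sat⇔ ρ) (K⊨ψ ρ))
    where
    Sat⇔ : ∀ ρ → Sat K _ ρ (λ _ _ → ⊥) ⇔ Sat K _ ρ (λ _ _ → ⊥)
    Sat⇔ ρ = Rewrites-⇔ (λ θ → Sat K θ ρ (λ _ _ → ⊥)) (λ s → Step-Sat K s) φ↝ψ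

  Agree-rewrites : ∀ {M N : Structure σ} {φ ψ} → Rewrites φ ψ → Agree M N ψ → Agree M N φ
  Agree-rewrites {M} {N} φ↝ψ (M⇒N , N⇒M) =
    from (⊨-rewrites N φ↝ψ) ∘ M⇒N ∘ to (⊨-rewrites M φ↝ψ) ,
    from (⊨-rewrites M φ↝ψ) ∘ N⇒M ∘ to (⊨-rewrites N φ↝ψ)

proposition3p2 :
    (∀ (k : ℕ) → k ≥ 1 → ∀ {σ : Schema} (M N : Structure σ) →
       M ≈UN[ k ] N →
       ∀ (φ : Formula σ) → Sentence φ → Width k φ → Agree M N φ)
    ×
    (∀ {σ : Schema} (M N : Structure σ) → M ≈UN N →
       ∀ (φ : Formula σ) → Sentence φ → Agree M N φ)
proposition3p2 = width-bounded , unbounded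
  where
  width-bounded : ∀ (k : ℕ) → k ≥ 1 → ∀ {σ : Schema} (M N : Structure σ) → M ≈UN[ k ] N →
                  ∀ (φ : Formula σ) → Sentence φ → Width k φ → Agree M N φ
  width-bounded k _ M N M≈N φ (uφ , closed , _) (ψ , φ↝ψ , nf , vs , |vs|≤k , vars⊆vs) =
    Agree-rewrites φ↝ψ (Agree-transfer (toBisim M≈N) (Rewrites-closed φ↝ψ closed) λ c →
      WidthBounded.point-transfer vs |vs|≤k c ψ nf (to (Rewrites-⇔ UNFP Step-UNFP φ↝ψ) uφ) vars⊆vs)

  unbounded : ∀ {σ : Schema} (M N : Structure σ) → M ≈UN N →
              ∀ (φ : Formula σ) → Sentence φ → Agree M N φ
  unbounded M N M≈N φ (uφ , closed , _) =
    Agree-transfer (toBisim M≈N) closed λ c → Unbounded.point-transfer (λ _ → tt) c φ uφ
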